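{- For every $n\in\mathbb{N}$, there is a set covering instance $(P,\mathcal{T},c)$ with $|P|=n$ players and nonempty core such that no family $\mathcal{C}'\subseteq\mathcal{C}$ with fewer than $2n-2$ elements determines the (happy) nucleolus.
   Context: A set covering instance $(P,\mathcal{T},c)$ consists of a finite set $P$ of players, a family $\mathcal{T}$ of subsets of $P$ whose union is $P$, and costs $c:\mathcal{T}\to\mathbb{R}_{\ge 0}$. For $\mathcal{U}\subseteq\mathcal{T}$ write $c(\mathcal{U})=\sum_{T\in\mathcal{U}}c(T)$; $\mathcal{U}$ covers $S\subseteq P$ if every element of $S$ lies in some set of $\mathcal{U}$. For $y\in\mathbb{R}^P$ write $y(S)=\sum_{p\in S}y_p$. A coalition is a nonempty subset of $P$. Let $\mathcal{C}$ be the set of pairs $(S,\mathcal{U})$ with $\emptyset\ne S\subseteq P$ and $\mathcal{U}\subseteq\mathcal{T}$ covering $S$. For $y\in\mathbb{R}^P_{\ge0}$, $\theta^y(S,\mathcal{U})=c(\mathcal{U})-y(S)$; $\theta^y(S)=\min\{\theta^y(S,\mathcal{U}):\mathcal{U}\subseteq\mathcal{T}\text{ covers }S\}$; the excess vector $\theta^y$ lists $\theta^y(S)$ over all coalitions in nondecreasing order; for $\mathcal{C}'\subseteq\mathcal{C}$, $\theta^y[\mathcal{C}']$ lists $\theta^y(S,\mathcal{U})$ for $(S,\mathcal{U})\in\mathcal{C}'$ in nondecreasing order. The core is the set of $y\in\mathbb{R}^P_{\ge0}$ with $y(P)$ equal to the minimum cost $\min\{c(\mathcal{U}):\mathcal{U}\subseteq\mathcal{T}\text{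 covers }P\}$ and $\theta^y(S)\ge0$ for all coalitions $S$. $\mathrm{LP}(P,\mathcal{T},c)=\min\{\sum_{T}c(T)x_T: x\in\mathbb{R}^{\mathcal{T}}_{\ge0},\ \sum_{T\ni p}x_T\ge1\ \forall p\in P\}$. The happy nucleolus is the (unique) $y\in\mathbb{R}^P_{\ge0}$ with $y(P)=\mathrm{LP}(P,\mathcal{T},c)$ lexicographically maximizing $\theta^y$ among such vectors; when the core is nonempty it coincides with the classical nucleolus. A family $\mathcal{C}'\subseteq\mathcal{C}$ determines the happy nucleolus if the happy nucleolus is the unique vector lexicographically maximizing $\theta^y[\mathcal{C}']$ among all $y\in\mathbb{R}^P_{\ge0}$ with $y(P)=\mathrm{LP}(P,\mathcal{T},c)$.
   Formalization: The costs $c$, the payoff vectors $y$ and the LP variables $x$ take values in ℚ instead of ℝ. -}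

module Defs where

open import Data.Nat using (ℕ; zero; suc)
open import Data.Bool using (Bool; true; false; if_then_else_)
open import Data.Fin using (Fin; zero; suc)
open import Data.Fin.Subset using (Subset; _∈_; ⊤; Nonempty; inside; outside)
open import Data.Fin.Subset.Properties using (_∈?_; nonempty?)
open import Data.Fin.Properties using (all?; any?)
open import Data.Vec using ([]; _∷_)
open import Data.List using (List; []; _∷_; map; filter; foldr; _++_)
open import Data.List.Relation.Unary.All using (All)
open import Data.List.Relation.Unary.Unique.Propositional using (Unique)
open import Data.List.Relation.Binary.Lex.Core using (Lex-<)
open import Data.Rational using (ℚ; 0ℚ; 1ℚ; _+_; _-_; _*_; _≤_; _<_; _⊓_)
open import Data.Rational.Properties using (≤-decTotalOrder)
open import Data.Product using (Σ; ∃; _×_; _,_; proj₁; proj₂)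
open import Relation.Nullary using (¬_; Dec; does)
open import Relation.Nullary.Decidable using (_×-dec_; _→-dec_)
open import Relation.Binary.PropositionalEquality using (_≡_)
open import Function using (_∘_)
open import Function.Definitions using (Injective)
import Data.List.Sort

open Data.List.Sort ≤-decTotalOrder using (sort)

sumFin : ∀ n → (Fin n → ℚ) → ℚ
sumFin zero    f = 0ℚ
sumFin (suc n) f = f zero + sumFin n (f ∘ suc)

sumSub : ∀ {n} → Subset n → (Fin n → ℚ) → ℚ
sumSub []            f = 0ℚ
sumSub (true  ∷ s)   f = f zero + sumSub s (f ∘ suc)
sumSub (false ∷ s)   f = sumSub s (f ∘ suc)

allSubsets : ∀ m → List (Subset m)
allSubsets zero    = [] ∷ []
allSubsets (suc m) = map (outside ∷_) (allSubsets m) ++ map (inside ∷_) (allSubsets m)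

record Instance (n : ℕ) : Set where
  field
    m        : ℕ
    T        : Fin m → Subset n
    distinct : Injective _≡_ _≡_ T
    c        : Fin m → ℚ
    c≥0      : ∀ t → 0ℚ ≤ c t
    union    : ∀ (p : Fin n) → ∃ λ t → p ∈ T t

module _ {n : ℕ} (I : Instance n) where
  open Instance I

  -- a subfamily 𝒰 ⊆ 𝒯 is a subset of the index set Fin m
  -- 𝒰 covers S
  Covers : Subset m → Subset n → Set
  Covers U S = ∀ p → p ∈ S → ∃ λ t → t ∈ U × p ∈ T t

  covers? : ∀ U S → Dec (Covers U S)
  covers? U S = all? (λ p → (p ∈? S) →-dec any? (λ t → (t ∈? U) ×-dec (p ∈? T t)))

  cost : Subset m → ℚ
  cost U = sumSub U c

  -- min { c(𝒰) : 𝒰 covers S }  (the full family 𝒯 always covers S, so the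
  -- fold starting with c(𝒯) is exactly this minimum)
  minCover : Subset n → ℚ
  minCover S = foldr _⊓_ (cost ⊤) (map cost (filter (λ U → covers? U S) (allSubsets m)))

  val : (Fin n → ℚ) → Subset n → ℚ
  val y S = sumSub S y

  θpair : (Fin n → ℚ) → Subset n × Subset m → ℚ
  θpair y (S , U) = cost U - val y S

  θ : (Fin n → ℚ) → Subset n → ℚ
  θ y S = minCover S - val y S

  coalitions : List (Subset n)
  coalitions = filter nonempty? (allSubsets n)

  excess : (Fin n → ℚ) → List ℚ
  excess y = sort (map (θ y) coalitions)

  excessOn : List (Subset n × Subset m) → (Fin n → ℚ) → List ℚ
  excessOn C' y = sort (map (θpair y) C')

  _<lex_ : List ℚ → List ℚ → Set
  _<lex_ = Lex-< _≡_ _<_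

  InCore : (Fin n → ℚ) → Set
  InCore y = (∀ p → 0ℚ ≤ y p) × (val y ⊤ ≡ minCover ⊤)
           × (∀ S → Nonempty S → 0ℚ ≤ θ y S)

  CoreNonempty : Set
  CoreNonempty = ∃ InCore

  FracCover : (Fin m → ℚ) → Set
  FracCover x = (∀ t → 0ℚ ≤ x t)
              × (∀ p → 1ℚ ≤ sumFin m (λ t → if does (p ∈? T t) then x t else 0ℚ))

  IsLPValue : ℚ → Set
  IsLPValue v = (∃ λ x → FracCover x × sumFin m (λ t → c t * x t) ≡ v)
              × (∀ x → FracCover x → v ≤ sumFin m (λ t → c t * x t))

  Feasible : (Fin n → ℚ) → Set
  Feasible y = (∀ p → 0ℚ ≤ y p) × IsLPValue (val y ⊤)

  IsHappyNucleolus : (Fin n → ℚ) → Set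
  IsHappyNucleolus y = Feasible y × (∀ y' → Feasible y' → ¬ (excess y <lex excess y'))

  SubfamilyOf𝒞 : List (Subset n × Subset m) → Set
  SubfamilyOf𝒞 C' = All (λ { (S , U) → Nonempty S × Covers U S }) C' × Unique C'

  LexMaxOn : List (Subset n × Subset m) → (Fin n → ℚ) → Set
  LexMaxOn C' y = Feasible y × (∀ y' → Feasible y' → ¬ (excessOn C' y <lex excessOn C' y'))

  Determines : List (Subset n × Subset m) → Set
  Determines C' = Σ (Fin n → ℚ) λ y → IsHappyNucleolus y × LexMaxOn C' y
                × (∀ y' → LexMaxOn C' y' → ∀ p → y' p ≡ y p)

-- For n ≥ 2 take 𝒯 = {P} ∪ {{i} : i ∈ P} with c(P) = W = Σᵢ 5ⁱ and c({i}) = 2·5ⁱ, and let y*ᵢ = 5ⁱ.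
-- A cover of S either contains P or costs at least 2·y*(S), so θ^{y*}(S) ≥ min (y*(S), y*(P∖S)) ≥ 0;
-- the cover {P} and the dual solution y* both have value W, so y* is a core point of value LP = W.
-- If a feasible y differs from y* and i₀ is the changed player of least weight, then {i₀} or P∖{i₀}
-- gets excess below y*ᵢ₀ under y, whereas every coalition whose excess changes has changed players
-- on both sides and hence y*-excess at least y*ᵢ₀: y* is the happy nucleolus.
--
-- All pair excesses θ^{y*}(S,𝒰) are integers, and reading c(𝒰) + y*(S′) in base 5 shows that two
-- pairs have the same excess only if their coalitions are equal or complementary. If 𝒞′ has fewer
-- than 2n - 2 pairs, fewer than n - 1 of its coalitions avoid player 0 and have a complementary
-- partner with the same excess, so some e ≠ 0 with e(P) = 0 vanishes on all of them, and hence on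
-- every coalition of 𝒞′ that has such a partner. Scaled to |e(S)| ≤ ½, either e leaves θ[𝒞′]
-- unchanged, so that y* + e is a second maximiser, or moving along ±e raises the least changed
-- excess while the integrality gap keeps every other changed excess above it, so that y* is not a
-- maximiser.
module Submission where

open import Data.Nat as ℕ using (ℕ; zero; suc)
import Data.Nat.Properties as ℕₚ
open import Data.Nat.DivMod using (_%_; [m+kn]%n≡m%n; m<n⇒m%n≡m)
import Data.Nat.Solver as ℕ-Solver
open import Data.Bool as Bool using (Bool; true; false; not; _xor_; if_then_else_)
open import Data.Bool.Properties using (not-injective; not-involutive)
import Data.Empty as Empty
open import Data.Fin using (Fin; zero; suc; toℕ)
import Data.Fin.Properties as Finₚ
open import Data.Fin.Subset using (Subset; _∈_; _∉_; _⊆_; ⊤; ⊥; ∁; ⁅_⁆; inside; outside; Nonempty)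
open import Data.Fin.Subset.Properties using (_∈?_; ∈⊤; drop-∷-⊆; x∈⁅x⁆; x∈⁅y⁆⇒x≡y; x∈p⇒x∉∁p; x∉p⇒x∈∁p; nonempty?)
open import Data.Vec using ([]; _∷_; here; there)
import Data.Vec.Properties as Vecₚ
open import Data.List using (List; []; _∷_; map; filter; foldr; length; _++_; deduplicate)
open import Data.List.Properties using (length-map; length-++; ∷-injective; filter-accept; filter-reject; map-cong; map-cong-local)
open import Data.List.Membership.Propositional using (find; lose) renaming (_∈_ to _∈ₗ_)
open import Data.List.Membership.Propositional.Properties using (∈-∃++; ∈-++⁺ˡ; ∈-++⁺ʳ; ∈-++⁻; ∈-map⁺; ∈-map⁻; ∈-filter⁺; ∈-filter⁻; ∈-deduplicate⁺; ∈-deduplicate⁻; ∈-allFin)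
open import Data.List.Relation.Unary.All as All using (All; []; _∷_)
import Data.List.Relation.Unary.All.Properties as Allₚ
open import Data.List.Relation.Unary.AllPairs using (_∷_)
open import Data.List.Relation.Unary.Any as Any using (Any; here; there; any?)
import Data.List.Relation.Unary.Linked as Linked
open import Data.List.Relation.Unary.Unique.Propositional using (Unique; []; _∷_)
import Data.List.Relation.Unary.Unique.Propositional.Properties as Uniqueₚ
open import Data.List.Relation.Unary.Unique.DecPropositional.Properties using (deduplicate-!)
open import Data.List.Relation.Binary.Lex.Core using (Lex-<; this; next)
open import Data.List.Relation.Binary.Permutation.Propositional using (_↭_; ↭-sym; ↭-trans; ↭-reflexive; ↭⇒↭ₛ)
open import Data.List.Relation.Binary.Permutation.Propositional.Properties using (shift; filter-↭; ↭-length; ∈-resp-↭; All-resp-↭)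
open import Data.List.Relation.Binary.Pointwise using (Pointwise-≡⇒≡)
open import Data.Rational using (ℚ; 0ℚ; 1ℚ; ½; _+_; _-_; _*_; -_; 1/_; ∣_∣; _≤_; _<_; _⊓_; NonZero; Positive; >-nonZero; ≢-nonZero; positive; nonNegative)
open import Data.Rational.Properties
import Data.Rational.Solver as ℚ-Solver
open import Algebra.Properties.Group +-0-group using (⁻¹-involutive)
open import Relation.Binary.Bundles using (DecTotalOrder; TotalOrder)
open import Data.List.Relation.Unary.Sorted.TotalOrder (DecTotalOrder.totalOrder ≤-decTotalOrder) using (Sorted)
open import Data.List.Relation.Unary.Sorted.TotalOrder.Properties using (Sorted⇒AllPairs; filter⁺; ↗↭↗⇒≋)
open import Data.List.Sort ≤-decTotalOrder using (sort; sort-↗; sort-↭)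
open import Data.List.Extrema (DecTotalOrder.totalOrder ≤-decTotalOrder) using (argmin; argmin-all; f[argmin]≤f[xs])
open import Data.Product using (Σ; ∃; _×_; _,_; proj₁; proj₂)
open import Data.Sum using (_⊎_; inj₁; inj₂; [_,_]′)
open import Function using (_∘_; _∘′_; id)
open import Function.Definitions using (Injective)
open import Relation.Binary.Definitions using (Tri; tri<; tri≈; tri>)
open import Relation.Binary.PropositionalEquality
open import Relation.Nullary using (¬_; Dec; yes; no; does; ¬?; contradiction)
open import Relation.Nullary.Decidable using (_×-dec_; decidable-stable; dec-true)
open import Relation.Unary using (Decidable)
open import Defs

-- Natural numbers and base-5 digits

2a≤b⇒b<2n∸2⇒1+a<n : ∀ {a b n} → 2 ℕ.* a ℕ.≤ b → b ℕ.< 2 ℕ.* n ℕ.∸ 2 → suc a ℕ.< n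
2a≤b⇒b<2n∸2⇒1+a<n {n = zero}  _     ()
2a≤b⇒b<2n∸2⇒1+a<n {a} {b} {suc n} 2a≤b b<2n =
  ℕ.s≤s (ℕₚ.*-cancelˡ-< 2 a n (ℕₚ.≤-<-trans 2a≤b (subst (λ z → b ℕ.< z ℕ.∸ 2) (ℕₚ.*-suc 2 n) b<2n)))

sumSubℕ : ∀ {n} → Subset n → (Fin n → ℕ) → ℕ
sumSubℕ []            f = 0
sumSubℕ (inside  ∷ S) f = f zero ℕ.+ sumSubℕ S (f ∘ suc)
sumSubℕ (outside ∷ S) f = sumSubℕ S (f ∘ suc)

sumSubℕ-*ˡ : ∀ {n} (S : Subset n) (k : ℕ) (f : Fin n → ℕ) → sumSubℕ S (λ i → k ℕ.* f i) ≡ k ℕ.* sumSubℕ S f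
sumSubℕ-*ˡ []            k f = sym (ℕₚ.*-zeroʳ k)
sumSubℕ-*ˡ (inside  ∷ S) k f =
  trans (cong (k ℕ.* f zero ℕ.+_) (sumSubℕ-*ˡ S k (f ∘ suc))) (sym (ℕₚ.*-distribˡ-+ k (f zero) _))
sumSubℕ-*ˡ (outside ∷ S) k f = sumSubℕ-*ˡ S k (f ∘ suc)

bit : Bool → ℕ
bit false = 0
bit true  = 1

pow5 : ∀ {n} → Fin n → ℕ
pow5 i = 5 ℕ.^ toℕ i

base5 : ∀ {n} → Subset n → ℕ
base5 S = sumSubℕ S pow5

base5-∷ : ∀ {n} b (S : Subset n) → base5 (b ∷ S) ≡ bit b ℕ.+ 5 ℕ.* base5 S
base5-∷ inside  S = cong suc (sumSubℕ-*ˡ S 5 pow5)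
base5-∷ outside S = sumSubℕ-*ˡ S 5 pow5

digit : Bool → Bool → Bool → ℕ
digit p u s = bit p ℕ.+ 2 ℕ.* bit u ℕ.+ bit s

digit<5 : ∀ p u s → digit p u s ℕ.< 5
digit<5 p u s = ℕ.s≤s (ℕₚ.+-mono-≤ (ℕₚ.+-mono-≤ (bit≤1 p) (ℕₚ.*-monoʳ-≤ 2 (bit≤1 u))) (bit≤1 s))
  where
  bit≤1 : ∀ b → bit b ℕ.≤ 1
  bit≤1 false = ℕ.z≤n
  bit≤1 true  = ℕₚ.≤-refl

digit%2 : ∀ p u s → digit p u s % 2 ≡ bit (p xor s)
digit%2 false false false = refl
digit%2 false false true  = refl
digit%2 false true  false = refl
digit%2 false true  true  = refl
digit%2 true  false false = refl
digit%2 true  false true  = refl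
digit%2 true  true  false = refl
digit%2 true  true  true  = refl

bit-injective : ∀ {a b} → bit a ≡ bit b → a ≡ b
bit-injective {false} {false} _ = refl
bit-injective {true}  {true}  _ = refl

xor-coincidence : ∀ p p′ s s′ → p xor s′ ≡ p′ xor s → (p ≡ p′ → s′ ≡ s) × (p ≢ p′ → s′ ≡ not s)
xor-coincidence false false s s′ eq = (λ _ → eq) , λ p≢p′ → contradiction refl p≢p′
xor-coincidence true  true  s s′ eq = (λ _ → not-injective eq) , λ p≢p′ → contradiction refl p≢p′
xor-coincidence false true  s s′ eq = (λ ()) , λ _ → eq
xor-coincidence true  false s s′ eq = (λ ()) , λ _ → trans (sym (not-involutive s′)) (cong not eq)

base5-digit-unique : ∀ {a b x y} → a ℕ.< 5 → b ℕ.< 5 → a ℕ.+ 5 ℕ.* x ≡ b ℕ.+ 5 ℕ.* y → a ≡ b × x ≡ y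
base5-digit-unique {a} {b} {x} {y} a<5 b<5 eq = a≡b , x≡y
  where
  open ≡-Reasoning
  a≡b : a ≡ b
  a≡b = begin
    a                          ≡⟨ sym (m<n⇒m%n≡m a<5) ⟩
    a % 5                      ≡⟨ sym ([m+kn]%n≡m%n a x 5) ⟩
    (a ℕ.+ x ℕ.* 5) % 5        ≡⟨ cong (λ z → (a ℕ.+ z) % 5) (ℕₚ.*-comm x 5) ⟩
    (a ℕ.+ 5 ℕ.* x) % 5        ≡⟨ cong (_% 5) eq ⟩
    (b ℕ.+ 5 ℕ.* y) % 5        ≡⟨ cong (λ z → (b ℕ.+ z) % 5) (ℕₚ.*-comm 5 y) ⟩
    (b ℕ.+ y ℕ.* 5) % 5        ≡⟨ [m+kn]%n≡m%n b y 5 ⟩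
    b % 5                      ≡⟨ m<n⇒m%n≡m b<5 ⟩
    b                          ∎
  x≡y : x ≡ y
  x≡y = ℕₚ.*-cancelˡ-≡ x y 5 (ℕₚ.+-cancelˡ-≡ b _ _ (subst (λ z → z ℕ.+ 5 ℕ.* x ≡ b ℕ.+ 5 ℕ.* y) a≡b eq))

-- The cost of the cover p ∷ U in the construction plus y*(S); its i-th base-5 digit is
-- digit p (U i) (S i).
digits : ∀ {n} → Bool → Subset n → Subset n → ℕ
digits {n} p U S = bit p ℕ.* base5 (⊤ {n}) ℕ.+ 2 ℕ.* base5 U ℕ.+ base5 S

digits-∷ : ∀ {n} p u s (U S : Subset n) → digits p (u ∷ U) (s ∷ S) ≡ digit p u s ℕ.+ 5 ℕ.* digits p U S
digits-∷ {n} p u s U S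
  rewrite base5-∷ inside (⊤ {n}) | base5-∷ u U | base5-∷ s S = solve 6
    (λ p w u U s S → p :* (con 1 :+ con 5 :* w) :+ con 2 :* (u :+ con 5 :* U) :+ (s :+ con 5 :* S)
                  := (p :+ con 2 :* u :+ s) :+ con 5 :* (p :* w :+ con 2 :* U :+ S))
    refl (bit p) (base5 (⊤ {n})) (bit u) (base5 U) (bit s) (base5 S)
  where open ℕ-Solver.+-*-Solver

digits-coincidence : ∀ {n} p p′ (U U′ S S′ : Subset n) → digits p U S′ ≡ digits p′ U′ S →
                     (p ≡ p′ → S′ ≡ S) × (p ≢ p′ → S′ ≡ ∁ S)
digits-coincidence p p′ [] [] [] [] _ = (λ _ → refl) , (λ _ → refl)
digits-coincidence p p′ (u ∷ U) (u′ ∷ U′) (s ∷ S) (s′ ∷ S′) eq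
  with base5-digit-unique (digit<5 p u s′) (digit<5 p′ u′ s)
         (trans (sym (digits-∷ p u s′ U S′)) (trans eq (digits-∷ p′ u′ s U′ S)))
... | digit≡ , rest≡ =
  (λ p≡p′ → cong₂ _∷_ (proj₁ here≡ p≡p′) (proj₁ later≡ p≡p′)) ,
  (λ p≢p′ → cong₂ _∷_ (proj₂ here≡ p≢p′) (proj₂ later≡ p≢p′))
  where
  here≡ = xor-coincidence p p′ s s′
            (bit-injective (trans (sym (digit%2 p u s′)) (trans (cong (_% 2) digit≡) (digit%2 p′ u′ s))))
  later≡ = digits-coincidence p p′ U U′ S S′ rest≡

open ℚ-Solver.+-*-Solver

p≤q+p : ∀ {p q} → 0ℚ ≤ q → p ≤ q + p
p≤q+p {p} {q} 0≤q = subst (_≤ q + p) (+-identityˡ p) (+-monoˡ-≤ p 0≤q)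

p≤p+q : ∀ {p q} → 0ℚ ≤ q → p ≤ p + q
p≤p+q {p} {q} 0≤q = subst (_≤ p + q) (+-identityʳ p) (+-monoʳ-≤ p 0≤q)

p-[p-q]≡q : ∀ p q → p - (p - q) ≡ q
p-[p-q]≡q = solve 2 (λ p q → p :- (p :- q) := q) refl

[p+p]-p≡p : ∀ p → (p + p) - p ≡ p
[p+p]-p≡p = solve 1 (λ p → (p :+ p) :- p := p) refl

p-[q+r]≡p-q-r : ∀ p q r → p - (q + r) ≡ p - q - r
p-[q+r]≡p-q-r = solve 3 (λ p q r → p :- (q :+ r) := p :- q :- r) refl

p+q≡p⇒q≡0 : ∀ {p q} → p + q ≡ p → q ≡ 0ℚ
p+q≡p⇒q≡0 {p} {q} p+q≡p = begin
  q              ≡⟨ solve 2 (λ p q → q := (p :+ q) :- p) refl p q ⟩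
  (p + q) - p    ≡⟨ cong (_- p) p+q≡p ⟩
  p - p          ≡⟨ +-inverseʳ p ⟩
  0ℚ             ∎
  where
  open ≡-Reasoning

0≤p-q⇒q≤p : ∀ {p q} → 0ℚ ≤ p - q → q ≤ p
0≤p-q⇒q≤p {p} {q} 0≤p-q = subst₂ _≤_ (+-identityˡ q) (solve 2 (λ p q → (p :- q) :+ q := p) refl p q) (+-monoˡ-≤ q 0≤p-q)

≤∧≢⇒< : ∀ {p q} → p ≤ q → p ≢ q → p < q
≤∧≢⇒< {p} {q} p≤q p≢q with <-cmp p q
... | tri< p<q _ _ = p<q
... | tri≈ _ p≡q _ = contradiction p≡q p≢q
... | tri> _ _ q<p = contradiction (≤-<-trans p≤q q<p) (<-irrefl refl)

≤⇒≯ : ∀ {p q} → p ≤ q → ¬ q < p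
≤⇒≯ p≤q q<p = <-irrefl refl (≤-<-trans p≤q q<p)

-≡-⇒+≡+ : ∀ {p q r s} → p - q ≡ r - s → p + s ≡ r + q
-≡-⇒+≡+ {p} {q} {r} {s} eq = begin
  p + s                 ≡⟨ solve 3 (λ p q s → p :+ s := (p :- q) :+ (q :+ s)) refl p q s ⟩
  (p - q) + (q + s)     ≡⟨ cong (_+ (q + s)) eq ⟩
  (r - s) + (q + s)     ≡⟨ solve 3 (λ r q s → (r :- s) :+ (q :+ s) := r :+ q) refl r q s ⟩
  r + q                 ∎
  where open ≡-Reasoning

-<-⇒+<+ : ∀ {p q r s} → p - q < r - s → p + s < r + q
-<-⇒+<+ {p} {q} {r} {s} lt = subst₂ _<_
  (solve 3 (λ p q s → (p :- q) :+ (q :+ s) := p :+ s) refl p q s)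
  (solve 3 (λ r q s → (r :- s) :+ (q :+ s) := r :+ q) refl r q s)
  (+-monoˡ-< (q + s) lt)

+≤+⇒-≤- : ∀ {p q r s} → p + s ≤ r + q → p - q ≤ r - s
+≤+⇒-≤- {p} {q} {r} {s} le = subst₂ _≤_
  (solve 3 (λ p q s → (p :+ s) :- (q :+ s) := p :- q) refl p q s)
  (solve 3 (λ r q s → (r :+ q) :- (q :+ s) := r :- s) refl r q s)
  (+-monoˡ-≤ (- (q + s)) le)

p≤∣p∣ : ∀ p → p ≤ ∣ p ∣
p≤∣p∣ p with ∣p∣≡p∨∣p∣≡-p p
... | inj₁ ∣p∣≡p  = ≤-reflexive (sym ∣p∣≡p)
... | inj₂ ∣p∣≡-p = ≤-trans p≤0 (0≤∣p∣ p)
  where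
  p≤0 : p ≤ 0ℚ
  p≤0 = subst (_≤ 0ℚ) (⁻¹-involutive p) (neg-antimono-≤ (subst (0ℚ ≤_) ∣p∣≡-p (0≤∣p∣ p)))

∣p∣≤q⇒p≤q : ∀ {p q} → ∣ p ∣ ≤ q → p ≤ q
∣p∣≤q⇒p≤q {p} = ≤-trans (p≤∣p∣ p)

∣p∣≤q⇒-q≤p : ∀ {p q} → ∣ p ∣ ≤ q → - q ≤ p
∣p∣≤q⇒-q≤p {p} ∣p∣≤q =
  subst (_ ≤_) (⁻¹-involutive p) (neg-antimono-≤ (≤-trans (subst (- p ≤_) (∣-p∣≡∣p∣ p) (p≤∣p∣ (- p))) ∣p∣≤q))

unit-gap-absorbs-½ : ∀ {a b d d′} → a + 1ℚ ≤ b → ∣ d ∣ ≤ ½ → ∣ d′ ∣ ≤ ½ → a - d ≤ b - d′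
unit-gap-absorbs-½ {a} {b} {d} {d′} a+1≤b ∣d∣≤½ ∣d′∣≤½ = begin
  a - d            ≤⟨ +-monoʳ-≤ a (neg-antimono-≤ (∣p∣≤q⇒-q≤p ∣d∣≤½)) ⟩
  a + ½            ≡⟨ solve 1 (λ a → a :+ con ½ := (a :+ con 1ℚ) :- con ½) refl a ⟩
  (a + 1ℚ) - ½     ≤⟨ +-mono-≤ a+1≤b (neg-antimono-≤ (∣p∣≤q⇒p≤q ∣d′∣≤½)) ⟩
  b - d′           ∎
  where
  open ≤-Reasoning

*-zero-cancelˡ : ∀ p .{{_ : NonZero p}} q → p * q ≡ 0ℚ → q ≡ 0ℚ
*-zero-cancelˡ p q pq≡0 = begin
  q                  ≡⟨ sym (*-identityˡ q) ⟩
  1ℚ * q             ≡⟨ cong (_* q) (sym (*-inverseˡ p)) ⟩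
  (1/ p * p) * q     ≡⟨ *-assoc (1/ p) p q ⟩
  1/ p * (p * q)     ≡⟨ cong (1/ p *_) pq≡0 ⟩
  1/ p * 0ℚ          ≡⟨ *-zeroʳ (1/ p) ⟩
  0ℚ                 ∎
  where open ≡-Reasoning

fromℕ : ℕ → ℚ
fromℕ zero    = 0ℚ
fromℕ (suc n) = 1ℚ + fromℕ n

fromℕ-1 : fromℕ 1 ≡ 1ℚ
fromℕ-1 = +-identityʳ 1ℚ

fromℕ-+ : ∀ m n → fromℕ (m ℕ.+ n) ≡ fromℕ m + fromℕ n
fromℕ-+ zero    n = sym (+-identityˡ (fromℕ n))
fromℕ-+ (suc m) n = trans (cong (1ℚ +_) (fromℕ-+ m n)) (sym (+-assoc 1ℚ (fromℕ m) (fromℕ n)))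

fromℕ<fromℕ-suc : ∀ n → fromℕ n < fromℕ (suc n)
fromℕ<fromℕ-suc n = subst (_< fromℕ (suc n)) (+-identityˡ (fromℕ n)) (+-monoˡ-< (fromℕ n) (positive⁻¹ 1ℚ))

fromℕ-nonneg : ∀ n → 0ℚ ≤ fromℕ n
fromℕ-nonneg zero    = ≤-refl
fromℕ-nonneg (suc n) = ≤-trans (fromℕ-nonneg n) (<⇒≤ (fromℕ<fromℕ-suc n))

fromℕ-mono-≤ : ∀ {m n} → m ℕ.≤ n → fromℕ m ≤ fromℕ n
fromℕ-mono-≤ {n = n} ℕ.z≤n = fromℕ-nonneg n
fromℕ-mono-≤ (ℕ.s≤s m≤n)   = +-monoʳ-≤ 1ℚ (fromℕ-mono-≤ m≤n)

fromℕ-mono-< : ∀ {m n} → m ℕ.< n → fromℕ m < fromℕ n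
fromℕ-mono-< {m} m<n = <-≤-trans (fromℕ<fromℕ-suc m) (fromℕ-mono-≤ m<n)

fromℕ-cancel-< : ∀ {m n} → fromℕ m < fromℕ n → m ℕ.< n
fromℕ-cancel-< {m} {n} p<q with ℕₚ.<-cmp m n
... | tri< m<n _ _ = m<n
... | tri≈ _ refl _ = contradiction p<q (<-irrefl refl)
... | tri> _ _ n<m = contradiction p<q (<-asym (fromℕ-mono-< n<m))

fromℕ-injective : ∀ {m n} → fromℕ m ≡ fromℕ n → m ≡ n
fromℕ-injective {m} {n} eq with ℕₚ.<-cmp m n
... | tri< m<n _ _ = contradiction eq (<⇒≢ (fromℕ-mono-< m<n))
... | tri≈ _ m≡n _ = m≡n
... | tri> _ _ n<m = contradiction (sym eq) (<⇒≢ (fromℕ-mono-< n<m))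

fromℕ-diff-injective : ∀ a b c d → fromℕ a - fromℕ b ≡ fromℕ c - fromℕ d → a ℕ.+ d ≡ c ℕ.+ b
fromℕ-diff-injective a b c d eq =
  fromℕ-injective (trans (fromℕ-+ a d) (trans (-≡-⇒+≡+ {fromℕ a} {fromℕ b} {fromℕ c} {fromℕ d} eq) (sym (fromℕ-+ c b))))

fromℕ-diff-gap : ∀ a b c d → fromℕ a - fromℕ b < fromℕ c - fromℕ d → fromℕ a - fromℕ b + 1ℚ ≤ fromℕ c - fromℕ d
fromℕ-diff-gap a b c d lt =
  subst (_≤ fromℕ c - fromℕ d) (solve 2 (λ a b → (con 1ℚ :+ a) :- b := a :- b :+ con 1ℚ) refl (fromℕ a) (fromℕ b))
    (+≤+⇒-≤- {fromℕ (suc a)} {fromℕ b} {fromℕ c} {fromℕ d}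
      (subst₂ _≤_ (fromℕ-+ (suc a) d) (fromℕ-+ c b) (fromℕ-mono-≤ a+d<c+b)))
  where
  a+d<c+b : a ℕ.+ d ℕ.< c ℕ.+ b
  a+d<c+b = fromℕ-cancel-< (subst₂ _<_ (sym (fromℕ-+ a d)) (sym (fromℕ-+ c b))
              (-<-⇒+<+ {fromℕ a} {fromℕ b} {fromℕ c} {fromℕ d} lt))

sumSub-cong : ∀ {n} (S : Subset n) {f g : Fin n → ℚ} → (∀ {p} → p ∈ S → f p ≡ g p) →
              sumSub S f ≡ sumSub S g
sumSub-cong []            f≡g = refl
sumSub-cong (inside  ∷ S) f≡g = cong₂ _+_ (f≡g here) (sumSub-cong S (f≡g ∘ there))
sumSub-cong (outside ∷ S) f≡g = sumSub-cong S (f≡g ∘ there)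

sumSub-+ : ∀ {n} (S : Subset n) (f g : Fin n → ℚ) →
           sumSub S (λ p → f p + g p) ≡ sumSub S f + sumSub S g
sumSub-+ []            f g = refl
sumSub-+ (inside  ∷ S) f g = trans (cong (f zero + g zero +_) (sumSub-+ S (f ∘ suc) (g ∘ suc)))
  (solve 4 (λ a b c d → (a :+ b) :+ (c :+ d) := (a :+ c) :+ (b :+ d)) refl
     (f zero) (g zero) (sumSub S (f ∘ suc)) (sumSub S (g ∘ suc)))
sumSub-+ (outside ∷ S) f g = sumSub-+ S (f ∘ suc) (g ∘ suc)

sumSub-*ˡ : ∀ {n} (S : Subset n) (k : ℚ) (f : Fin n → ℚ) → sumSub S (λ p → k * f p) ≡ k * sumSub S f
sumSub-*ˡ []            k f = sym (*-zeroʳ k)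
sumSub-*ˡ (inside  ∷ S) k f =
  trans (cong (k * f zero +_) (sumSub-*ˡ S k (f ∘ suc))) (sym (*-distribˡ-+ k (f zero) _))
sumSub-*ˡ (outside ∷ S) k f = sumSub-*ˡ S k (f ∘ suc)

sumSub-neg : ∀ {n} (S : Subset n) (f : Fin n → ℚ) → sumSub S (λ p → - f p) ≡ - sumSub S f
sumSub-neg []            f = refl
sumSub-neg (inside  ∷ S) f =
  trans (cong (- f zero +_) (sumSub-neg S (f ∘ suc))) (sym (neg-distrib-+ (f zero) _))
sumSub-neg (outside ∷ S) f = sumSub-neg S (f ∘ suc)

sumSub-zero : ∀ {n} (S : Subset n) → sumSub S (λ _ → 0ℚ) ≡ 0ℚ
sumSub-zero []            = refl
sumSub-zero (inside  ∷ S) = trans (cong (0ℚ +_) (sumSub-zero S)) (+-identityˡ 0ℚ)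
sumSub-zero (outside ∷ S) = sumSub-zero S

sumSub-⊥ : ∀ {n} (f : Fin n → ℚ) → sumSub ⊥ f ≡ 0ℚ
sumSub-⊥ {zero}  f = refl
sumSub-⊥ {suc n} f = sumSub-⊥ (f ∘ suc)

sumSub-⁅⁆ : ∀ {n} (p : Fin n) (f : Fin n → ℚ) → sumSub ⁅ p ⁆ f ≡ f p
sumSub-⁅⁆ zero    f = trans (cong (f zero +_) (sumSub-⊥ (f ∘ suc))) (+-identityʳ (f zero))
sumSub-⁅⁆ (suc p) f = sumSub-⁅⁆ p (f ∘ suc)

sumSub-∁ : ∀ {n} (S : Subset n) (f : Fin n → ℚ) → sumSub S f + sumSub (∁ S) f ≡ sumSub ⊤ f
sumSub-∁ []            f = refl
sumSub-∁ (inside  ∷ S) f =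
  trans (+-assoc (f zero) _ _) (cong (f zero +_) (sumSub-∁ S (f ∘ suc)))
sumSub-∁ (outside ∷ S) f =
  trans (solve 3 (λ a b c → b :+ (a :+ c) := a :+ (b :+ c)) refl (f zero) (sumSub S (f ∘ suc)) _)
        (cong (f zero +_) (sumSub-∁ S (f ∘ suc)))

sumSub-⊤ : ∀ n (f : Fin n → ℚ) → sumSub ⊤ f ≡ sumFin n f
sumSub-⊤ zero    f = refl
sumSub-⊤ (suc n) f = cong (f zero +_) (sumSub-⊤ n (f ∘ suc))

sumSub-mono-≤ : ∀ {n} (S : Subset n) {f g : Fin n → ℚ} → (∀ p → f p ≤ g p) → sumSub S f ≤ sumSub S g
sumSub-mono-≤ []            f≤g = ≤-refl
sumSub-mono-≤ (inside  ∷ S) f≤g = +-mono-≤ (f≤g zero) (sumSub-mono-≤ S (f≤g ∘ suc))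
sumSub-mono-≤ (outside ∷ S) f≤g = sumSub-mono-≤ S (f≤g ∘ suc)

sumSub-nonneg : ∀ {n} (S : Subset n) {f : Fin n → ℚ} → (∀ p → 0ℚ ≤ f p) → 0ℚ ≤ sumSub S f
sumSub-nonneg []            f≥0 = ≤-refl
sumSub-nonneg (inside  ∷ S) f≥0 = +-mono-≤ (f≥0 zero) (sumSub-nonneg S (f≥0 ∘ suc))
sumSub-nonneg (outside ∷ S) f≥0 = sumSub-nonneg S (f≥0 ∘ suc)

sumSub-mono-⊆ : ∀ {n} {S S′ : Subset n} {f : Fin n → ℚ} → (∀ p → 0ℚ ≤ f p) → S ⊆ S′ →
                sumSub S f ≤ sumSub S′ f
sumSub-mono-⊆ {S = []}          {[]}           f≥0 S⊆S′ = ≤-refl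
sumSub-mono-⊆ {S = inside  ∷ S} {inside  ∷ S′} {f} f≥0 S⊆S′ =
  +-monoʳ-≤ (f zero) (sumSub-mono-⊆ (f≥0 ∘ suc) (drop-∷-⊆ S⊆S′))
sumSub-mono-⊆ {S = inside  ∷ S} {outside ∷ S′} f≥0 S⊆S′ = contradiction (S⊆S′ here) λ ()
sumSub-mono-⊆ {S = outside ∷ S} {inside  ∷ S′} f≥0 S⊆S′ =
  ≤-trans (sumSub-mono-⊆ (f≥0 ∘ suc) (drop-∷-⊆ S⊆S′)) (p≤q+p (f≥0 zero))
sumSub-mono-⊆ {S = outside ∷ S} {outside ∷ S′} f≥0 S⊆S′ = sumSub-mono-⊆ (f≥0 ∘ suc) (drop-∷-⊆ S⊆S′)

sumSub-≥-∈ : ∀ {n} {S : Subset n} {f : Fin n → ℚ} → (∀ p → 0ℚ ≤ f p) → ∀ {p} → p ∈ S → f p ≤ sumSub S f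
sumSub-≥-∈ {S = S} {f} f≥0 {p} p∈S = subst (_≤ sumSub S f) (sumSub-⁅⁆ p f)
  (sumSub-mono-⊆ f≥0 λ q∈⁅p⁆ → subst (_∈ S) (sym (x∈⁅y⁆⇒x≡y p q∈⁅p⁆)) p∈S)

∣sumSub∣≤sumSub∣∣ : ∀ {n} (S : Subset n) (d : Fin n → ℚ) → ∣ sumSub S d ∣ ≤ sumSub S (∣_∣ ∘ d)
∣sumSub∣≤sumSub∣∣ []            d = ≤-refl
∣sumSub∣≤sumSub∣∣ (inside  ∷ S) d =
  ≤-trans (∣p+q∣≤∣p∣+∣q∣ (d zero) _) (+-monoʳ-≤ ∣ d zero ∣ (∣sumSub∣≤sumSub∣∣ S (d ∘ suc)))
∣sumSub∣≤sumSub∣∣ (outside ∷ S) d = ∣sumSub∣≤sumSub∣∣ S (d ∘ suc)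

sumSub-fromℕ : ∀ {n} (S : Subset n) (f : Fin n → ℕ) → sumSub S (fromℕ ∘ f) ≡ fromℕ (sumSubℕ S f)
sumSub-fromℕ []            f = refl
sumSub-fromℕ (inside  ∷ S) f =
  trans (cong (fromℕ (f zero) +_) (sumSub-fromℕ S (f ∘ suc))) (sym (fromℕ-+ (f zero) _))
sumSub-fromℕ (outside ∷ S) f = sumSub-fromℕ S (f ∘ suc)

sumSub-swap : ∀ {m n} (f : Fin m → Fin n → ℚ) →
              sumSub ⊤ (λ i → sumSub ⊤ (f i)) ≡ sumSub ⊤ (λ j → sumSub ⊤ (λ i → f i j))
sumSub-swap {zero}  {n} f = sym (sumSub-zero (⊤ {n}))
sumSub-swap {suc m} {n} f = trans (cong (sumSub ⊤ (f zero) +_) (sumSub-swap (f ∘ suc)))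
                                  (sym (sumSub-+ (⊤ {n}) (f zero) _))

sumSub-indicator : ∀ {n} (S : Subset n) (f : Fin n → ℚ) →
                   sumSub ⊤ (λ p → if does (p ∈? S) then f p else 0ℚ) ≡ sumSub S f
sumSub-indicator []            f = refl
sumSub-indicator (inside  ∷ S) f = cong (f zero +_) (sumSub-indicator S (f ∘ suc))
sumSub-indicator (outside ∷ S) f = trans (+-identityˡ _) (sumSub-indicator S (f ∘ suc))

∁-involutive : ∀ {n} (p : Subset n) → ∁ (∁ p) ≡ p
∁-involutive p = trans (sym (Vecₚ.map-∘ not not p)) (trans (Vecₚ.map-cong not-involutive p) (Vecₚ.map-id p))

∁-injective : ∀ {n} {p q : Subset n} → ∁ p ≡ ∁ q → p ≡ q
∁-injective {p = p} {q} ∁p≡∁q = trans (sym (∁-involutive p)) (trans (cong ∁ ∁p≡∁q) (∁-involutive q))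

_≟ₛ_ : ∀ {n} (p q : Subset n) → Dec (p ≡ q)
_≟ₛ_ = Vecₚ.≡-dec Bool._≟_

allSubsets-complete : ∀ m (U : Subset m) → U ∈ₗ allSubsets m
allSubsets-complete zero    []            = here refl
allSubsets-complete (suc m) (outside ∷ U) = ∈-++⁺ˡ (∈-map⁺ (outside ∷_) (allSubsets-complete m U))
allSubsets-complete (suc m) (inside  ∷ U) =
  ∈-++⁺ʳ (map (outside ∷_) (allSubsets m)) (∈-map⁺ (inside ∷_) (allSubsets-complete m U))

Unique-⊆⇒length≤ : ∀ {A : Set} {xs ys : List A} → Unique xs → (∀ {x} → x ∈ₗ xs → x ∈ₗ ys) →
                   length xs ℕ.≤ length ys
Unique-⊆⇒length≤ {xs = []}     []            _     = ℕ.z≤n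
Unique-⊆⇒length≤ {xs = x ∷ xs} (x∉xs ∷ xs!) xs⊆ys with ∈-∃++ (xs⊆ys (here refl))
... | ys₁ , ys₂ , refl =
  subst (suc (length xs) ℕ.≤_) (sym (↭-length (shift x ys₁ ys₂))) (ℕ.s≤s (Unique-⊆⇒length≤ xs! xs⊆rest))
  where
  xs⊆rest : ∀ {z} → z ∈ₗ xs → z ∈ₗ ys₁ ++ ys₂
  xs⊆rest z∈xs with ∈-resp-↭ (shift x ys₁ ys₂) (xs⊆ys (there z∈xs))
  ... | here z≡x     = contradiction (sym z≡x) (All.lookup x∉xs z∈xs)
  ... | there z∈rest = z∈rest

foldr-⊓-≤ : ∀ {p} z {ps} → p ∈ₗ ps → foldr _⊓_ z ps ≤ p
foldr-⊓-≤ z {q ∷ ps} (here refl) = p⊓q≤p q _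
foldr-⊓-≤ z {q ∷ ps} (there p∈ps) = ≤-trans (p⊓q≤q q _) (foldr-⊓-≤ z p∈ps)

foldr-⊓-greatest : ∀ {b} z ps → b ≤ z → (∀ {p} → p ∈ₗ ps → b ≤ p) → b ≤ foldr _⊓_ z ps
foldr-⊓-greatest z []       b≤z b≤ps = b≤z
foldr-⊓-greatest z (p ∷ ps) b≤z b≤ps = ⊓-glb (b≤ps (here refl)) (foldr-⊓-greatest z ps b≤z (b≤ps ∘ there))

≤-totalOrder : TotalOrder _ _ _
≤-totalOrder = DecTotalOrder.totalOrder ≤-decTotalOrder

∃-argmin : ∀ {I : Set} (f : I → ℚ) {P : I → Set} → Decidable P → ∀ {xs} → Any P xs →
           ∃ λ j → j ∈ₗ xs × P j × All (λ i → P i → f j ≤ f i) xs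
∃-argmin f {P} P? {xs} any = j₀ , proj₁ j₀∈xs∧Pj₀ , proj₂ j₀∈xs∧Pj₀ , All.tabulate minimal
  where
  j = proj₁ (find any)
  candidates = filter P? xs
  j₀ = argmin f j candidates
  j₀∈xs∧Pj₀ : j₀ ∈ₗ xs × P j₀
  j₀∈xs∧Pj₀ = argmin-all f (proj₁ (proj₂ (find any)) , proj₂ (proj₂ (find any)))
                           (All.tabulate (∈-filter⁻ P? {xs = xs}))
  minimal : ∀ {i} → i ∈ₗ xs → P i → f j₀ ≤ f i
  minimal i∈xs Pi = All.lookup (f[argmin]≤f[xs] j candidates) (∈-filter⁺ P? i∈xs Pi)

Sorted-head : ∀ {x xs} → Sorted (x ∷ xs) → All (x ≤_) xs
Sorted-head x∷xs↗ with Sorted⇒AllPairs ≤-totalOrder x∷xs↗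
... | x≤xs ∷ _ = x≤xs

Sorted-tail : ∀ {x xs} → Sorted (x ∷ xs) → Sorted xs
Sorted-tail = Linked.tail

Sorted-≥ : ∀ {s x xs} → s ≤ x → Sorted (x ∷ xs) → All (s ≤_) (x ∷ xs)
Sorted-≥ s≤x x∷xs↗ = s≤x ∷ All.map (≤-trans s≤x) (Sorted-head x∷xs↗)

↗↭↗⇒≡ : ∀ {xs ys} → Sorted xs → Sorted ys → xs ↭ ys → xs ≡ ys
↗↭↗⇒≡ xs↗ ys↗ xs↭ys = Pointwise-≡⇒≡ (↗↭↗⇒≋ ≤-totalOrder xs↗ ys↗ (↭⇒↭ₛ xs↭ys))

-- Lexicographic comparison of sorted lists

below : ℚ → List ℚ → List ℚ
below s = filter (_<? s)

count : ℚ → List ℚ → ℕ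
count s xs = length (filter (_≟ s) xs)

below-≥ : ∀ {s xs} → All (s ≤_) xs → below s xs ≡ []
below-≥ []                 = refl
below-≥ {s} (s≤x ∷ s≤xs) =
  trans (filter-reject (_<? s) λ x<s → <-irrefl refl (<-≤-trans x<s s≤x)) (below-≥ s≤xs)

count-∷-≢ : ∀ {s x} xs → x ≢ s → count s (x ∷ xs) ≡ count s xs
count-∷-≢ {s} xs x≢s = cong length (filter-reject (_≟ s) x≢s)

count-∷-≡ : ∀ {s x} xs → x ≡ s → count s (x ∷ xs) ≡ suc (count s xs)
count-∷-≡ {s} xs x≡s = cong length (filter-accept (_≟ s) x≡s)

count-∷-≥ : ∀ s x xs → count s xs ℕ.≤ count s (x ∷ xs)
count-∷-≥ s x xs with x ≟ s
... | yes _ = ℕₚ.n≤1+n _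
... | no  _ = ℕₚ.≤-refl

count-> : ∀ {s xs} → All (s <_) xs → count s xs ≡ 0
count-> []                 = refl
count-> {s} (s<x ∷ s<xs) = trans (count-∷-≢ _ (<⇒≢ s<x ∘′ sym)) (count-> s<xs)

Sorted-Lex-< : ∀ s {xs ys} → Sorted xs → Sorted ys → length xs ≡ length ys →
               below s xs ≡ below s ys → count s ys ℕ.< count s xs → Lex-< _≡_ _<_ xs ys
Sorted-Lex-< s {[]}     {[]}     _   _   _     _      ()
Sorted-Lex-< s {x ∷ xs} {y ∷ ys} xs↗ ys↗ |x∷xs| below≡ count< with x <? s | y <? s
... | yes x<s | yes y<s =
  next (proj₁ x∷≡y∷) (Sorted-Lex-< s (Sorted-tail xs↗) (Sorted-tail ys↗) (ℕₚ.suc-injective |x∷xs|)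
    (proj₂ x∷≡y∷) (subst₂ ℕ._<_ (count-∷-≢ ys (<⇒≢ y<s)) (count-∷-≢ xs (<⇒≢ x<s)) count<))
  where
  x∷≡y∷ = ∷-injective (trans (sym (filter-accept (_<? s) x<s)) (trans below≡ (filter-accept (_<? s) y<s)))
... | yes x<s | no y≮s =
  contradiction (trans (sym (filter-accept (_<? s) x<s)) (trans below≡ (below-≥ (Sorted-≥ (≮⇒≥ y≮s) ys↗)))) λ ()
... | no x≮s | yes y<s =
  contradiction (trans (sym (filter-accept (_<? s) y<s)) (trans (sym below≡) (below-≥ (Sorted-≥ (≮⇒≥ x≮s) xs↗)))) λ ()
... | no x≮s | no y≮s with <-cmp s x
...   | tri> _ _ x<s = contradiction x<s x≮s
...   | tri< s<x _ _ =
  contradiction (subst (_ ℕ.<_) (count-> (s<x ∷ All.map (<-≤-trans s<x) (Sorted-head xs↗))) count<) ℕₚ.n≮0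
...   | tri≈ _ refl _ with <-cmp x y
...     | tri< x<y _ _ = this x<y
...     | tri> _ _ y<x = contradiction y<x y≮s
...     | tri≈ _ refl _ = next refl (Sorted-Lex-< x (Sorted-tail xs↗) (Sorted-tail ys↗) (ℕₚ.suc-injective |x∷xs|)
                       (trans (below-≥ (Sorted-head xs↗)) (sym (below-≥ (Sorted-head ys↗))))
                       (ℕₚ.≤-pred (subst₂ ℕ._<_ (count-∷-≡ ys refl) (count-∷-≡ xs refl) count<)))

filter-∷-cong : ∀ {A : Set} {P : A → Set} (P? : Decidable P) x {xs ys} →
                filter P? xs ≡ filter P? ys → filter P? (x ∷ xs) ≡ filter P? (x ∷ ys)
filter-∷-cong P? x eq with does (P? x)
... | true  = cong (x ∷_) eq
... | false = eq

module _ {I : Set} (f g : I → ℚ) where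

  below-map : ∀ s {xs} → All (λ i → f i ≡ g i ⊎ (s ≤ f i × s ≤ g i)) xs →
              below s (map f xs) ≡ below s (map g xs)
  below-map s []                               = refl
  below-map s {i ∷ xs} (inj₁ fi≡gi ∷ rest) =
    trans (filter-∷-cong (_<? s) (f i) (below-map s rest)) (cong (λ z → below s (z ∷ map g xs)) fi≡gi)
  below-map s (inj₂ (s≤fi , s≤gi) ∷ rest) =
    trans (filter-reject (_<? s) (≤⇒≯ s≤fi)) (trans (below-map s rest) (sym (filter-reject (_<? s) (≤⇒≯ s≤gi))))

  count-map-≤ : ∀ s {xs} → All (λ i → g i ≡ s → f i ≡ s) xs → count s (map g xs) ℕ.≤ count s (map f xs)
  count-map-≤ s []                 = ℕ.z≤n
  count-map-≤ s {i ∷ xs} (g≡⇒f≡ ∷ rest) with g i ≟ s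
  ... | yes gi≡s = ℕₚ.≤-trans (ℕ.s≤s (count-map-≤ s rest)) (ℕₚ.≤-reflexive (sym (count-∷-≡ (map f xs) (g≡⇒f≡ gi≡s))))
  ... | no  _    = ℕₚ.≤-trans (count-map-≤ s rest) (count-∷-≥ s (f i) (map f xs))

  count-map-< : ∀ s {xs} → All (λ i → g i ≡ s → f i ≡ s) xs → Any (λ j → f j ≡ s × g j ≢ s) xs →
                count s (map g xs) ℕ.< count s (map f xs)
  count-map-< s {j ∷ xs} (_ ∷ rest) (here (fj≡s , gj≢s)) =
    ℕₚ.≤-trans (ℕ.s≤s (ℕₚ.≤-reflexive (count-∷-≢ (map g xs) gj≢s)))
      (ℕₚ.≤-trans (ℕ.s≤s (count-map-≤ s rest)) (ℕₚ.≤-reflexive (sym (count-∷-≡ (map f xs) fj≡s))))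
  count-map-< s {i ∷ xs} (g≡⇒f≡ ∷ rest) (there any) with g i ≟ s
  ... | yes gi≡s = ℕₚ.≤-trans (ℕ.s≤s (count-map-< s rest any)) (ℕₚ.≤-reflexive (sym (count-∷-≡ (map f xs) (g≡⇒f≡ gi≡s))))
  ... | no  _    = ℕₚ.≤-trans (count-map-< s rest any) (count-∷-≥ s (f i) (map f xs))

  -- With s the least value of f at a changed index, both sorted lists agree below s and s occurs
  -- more often in the first.
  sort-map-Lex-< : ∀ {xs} t → Any (λ j → f j < t × f j ≢ g j) xs → All (λ i → f i ≢ g i → t ≤ g i) xs →
                   Lex-< _≡_ _<_ (sort (map f xs)) (sort (map g xs))
  sort-map-Lex-< {xs} t witness changed⇒t≤g =
    Sorted-Lex-< s (sort-↗ (map f xs)) (sort-↗ (map g xs)) lengths≡ belows≡ counts<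
    where
    changed? : Decidable (λ i → f i ≢ g i)
    changed? i = ¬? (f i ≟ g i)
    minimiser = ∃-argmin f changed? (Any.map proj₂ witness)
    j₀ = proj₁ minimiser
    s = f j₀
    minimal : All (λ i → f i ≢ g i → s ≤ f i) xs
    minimal = proj₂ (proj₂ (proj₂ minimiser))
    s<t : s < t
    s<t with find witness
    ... | j , j∈xs , fj<t , changed = ≤-<-trans (All.lookup minimal j∈xs changed) fj<t
    lengths≡ : length (sort (map f xs)) ≡ length (sort (map g xs))
    lengths≡ = trans (↭-length (sort-↭ (map f xs))) (trans (length-map f xs)
                 (sym (trans (↭-length (sort-↭ (map g xs))) (length-map g xs))))
    unchanged-or-≥s : All (λ i → f i ≡ g i ⊎ (s ≤ f i × s ≤ g i)) xs
    unchanged-or-≥s = All.zipWith agree (minimal , changed⇒t≤g)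
      where
      agree : ∀ {i} → (f i ≢ g i → s ≤ f i) × (f i ≢ g i → t ≤ g i) → f i ≡ g i ⊎ (s ≤ f i × s ≤ g i)
      agree {i} (s≤fi , t≤gi) with f i ≟ g i
      ... | yes fi≡gi = inj₁ fi≡gi
      ... | no  fi≢gi = inj₂ (s≤fi fi≢gi , ≤-trans (<⇒≤ s<t) (t≤gi fi≢gi))
    belows≡ : below s (sort (map f xs)) ≡ below s (sort (map g xs))
    belows≡ = ↗↭↗⇒≡ (filter⁺ ≤-totalOrder (_<? s) (sort-↗ (map f xs))) (filter⁺ ≤-totalOrder (_<? s) (sort-↗ (map g xs)))
      (↭-trans (filter-↭ (_<? s) (sort-↭ (map f xs)))
        (↭-trans (↭-reflexive (below-map s unchanged-or-≥s)) (↭-sym (filter-↭ (_<? s) (sort-↭ (map g xs))))))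
    g≡s⇒f≡s : All (λ i → g i ≡ s → f i ≡ s) xs
    g≡s⇒f≡s = All.map unchanged changed⇒t≤g
      where
      unchanged : ∀ {i} → (f i ≢ g i → t ≤ g i) → g i ≡ s → f i ≡ s
      unchanged {i} t≤gi gi≡s with f i ≟ g i
      ... | yes fi≡gi = trans fi≡gi gi≡s
      ... | no  fi≢gi = contradiction s<t (≤⇒≯ (subst (t ≤_) gi≡s (t≤gi fi≢gi)))
    counts< : count s (sort (map g xs)) ℕ.< count s (sort (map f xs))
    counts< = subst₂ ℕ._<_ (sym (↭-length (filter-↭ (_≟ s) (sort-↭ (map g xs)))))
                          (sym (↭-length (filter-↭ (_≟ s) (sort-↭ (map f xs)))))
                (count-map-< s g≡s⇒f≡s (lose (proj₁ (proj₂ minimiser)) (refl , proj₁ (proj₂ (proj₂ minimiser)) ∘′ sym)))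

-- Linear algebra

infix 7 _·_
_·_ : ∀ {n} → (Fin n → ℚ) → (Fin n → ℚ) → ℚ
u · v = sumSub ⊤ (λ i → u i * v i)

·-zeroˡ : ∀ {n} {u : Fin n → ℚ} (v : Fin n → ℚ) → (∀ i → u i ≡ 0ℚ) → u · v ≡ 0ℚ
·-zeroˡ {n} {u} v u≡0 = trans (sumSub-cong (⊤ {n}) λ {i} _ → trans (cong (_* v i) (u≡0 i)) (*-zeroˡ (v i))) (sumSub-zero (⊤ {n}))

·-zeroʳ : ∀ {n} (u : Fin n → ℚ) {v : Fin n → ℚ} → (∀ i → v i ≡ 0ℚ) → u · v ≡ 0ℚ
·-zeroʳ {n} u {v} v≡0 = trans (sumSub-cong (⊤ {n}) λ {i} _ → trans (cong (u i *_) (v≡0 i)) (*-zeroʳ (u i))) (sumSub-zero (⊤ {n}))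

·-linearˡ : ∀ {n} (u v w : Fin n → ℚ) (c : ℚ) → (λ i → u i + c * v i) · w ≡ u · w + c * (v · w)
·-linearˡ {n} u v w c = begin
  sumSub ⊤ (λ i → (u i + c * v i) * w i)         ≡⟨ sumSub-cong (⊤ {n}) (λ {i} _ → distrib i) ⟩
  sumSub ⊤ (λ i → u i * w i + c * (v i * w i))   ≡⟨ sumSub-+ (⊤ {n}) _ _ ⟩
  u · w + sumSub ⊤ (λ i → c * (v i * w i))       ≡⟨ cong (u · w +_) (sumSub-*ˡ (⊤ {n}) c _) ⟩
  u · w + c * (v · w)                            ∎
  where
  open ≡-Reasoning
  distrib : ∀ i → (u i + c * v i) * w i ≡ u i * w i + c * (v i * w i)
  distrib i = solve 4 (λ a b c d → (a :+ c :* b) :* d := a :* d :+ c :* (b :* d)) refl (u i) (v i) c (w i)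

·-scaleʳ : ∀ {n} (u v : Fin n → ℚ) (c : ℚ) → u · (λ i → c * v i) ≡ c * (u · v)
·-scaleʳ {n} u v c = trans (sumSub-cong (⊤ {n}) λ {i} _ → solve 3 (λ a b c → a :* (c :* b) := c :* (a :* b)) refl (u i) (v i) c)
                           (sumSub-*ˡ (⊤ {n}) c _)

χ : ∀ {n} → Subset n → Fin n → ℚ
χ (inside  ∷ _) zero    = 1ℚ
χ (outside ∷ _) zero    = 0ℚ
χ (_       ∷ S) (suc i) = χ S i

χ·≡sumSub : ∀ {n} (S : Subset n) (d : Fin n → ℚ) → χ S · d ≡ sumSub S d
χ·≡sumSub []            d = refl
χ·≡sumSub (inside  ∷ S) d = cong₂ _+_ (*-identityˡ (d zero)) (χ·≡sumSub S (d ∘ suc))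
χ·≡sumSub (outside ∷ S) d = trans (cong₂ _+_ (*-zeroˡ (d zero)) (χ·≡sumSub S (d ∘ suc))) (+-identityˡ _)

NonZeroVec : ∀ {n} → (Fin n → ℚ) → Set
NonZeroVec d = ∃ λ i → d i ≢ 0ℚ

∃-pivot : ∀ {n} (vs : List (Fin (suc n) → ℚ)) →
          All (λ v → v zero ≡ 0ℚ) vs ⊎ (∃ λ v → ∃ λ rest → v zero ≢ 0ℚ × vs ↭ v ∷ rest)
∃-pivot vs with any? (λ v → ¬? (v zero ≟ 0ℚ)) vs
... | no  none = inj₁ (All.map (decidable-stable (_ ≟ 0ℚ)) (Allₚ.¬Any⇒All¬ vs none))
... | yes some with find some
...   | v , v∈vs , v₀≢0 with ∈-∃++ v∈vs
...     | as , bs , refl = inj₂ (v , as ++ bs , v₀≢0 , shift v as bs)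

module Elimination {n} (v : Fin (suc n) → ℚ) .{{_ : NonZero (v zero)}} where

  coeff : (Fin (suc n) → ℚ) → ℚ
  coeff u = - (u zero * 1/ v zero)

  reduce : (Fin (suc n) → ℚ) → Fin n → ℚ
  reduce u i = u (suc i) + coeff u * v (suc i)

  extend : (Fin n → ℚ) → Fin (suc n) → ℚ
  extend d zero    = - (1/ v zero * ((v ∘ suc) · d))
  extend d (suc i) = d i

  ·extend≡reduce· : ∀ u d → u · extend d ≡ reduce u · d
  ·extend≡reduce· u d = trans
    (solve 4 (λ a b x y → a :* (:- (b :* x)) :+ y := y :+ (:- (a :* b)) :* x) refl
       (u zero) (1/ v zero) ((v ∘ suc) · d) ((u ∘ suc) · d))
    (sym (·-linearˡ (u ∘ suc) (v ∘ suc) d (coeff u)))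

  reduce-pivot≡0 : ∀ i → reduce v i ≡ 0ℚ
  reduce-pivot≡0 i = trans (cong (λ z → v (suc i) + - z * v (suc i)) (*-inverseʳ (v zero)))
                           (solve 1 (λ a → a :+ (:- con 1ℚ) :* a := con 0ℚ) refl (v (suc i)))

∃-orthogonal : ∀ n (vs : List (Fin n → ℚ)) → length vs ℕ.< n →
               ∃ λ d → NonZeroVec d × All (λ v → v · d ≡ 0ℚ) vs
∃-orthogonal zero    vs ()
∃-orthogonal (suc n) vs |vs|<1+n with ∃-pivot vs
... | inj₁ vs₀≡0 = e₀ , (zero , λ ()) , All.map (λ {v} → v·e₀≡0 {v}) vs₀≡0
  where
  e₀ : Fin (suc n) → ℚ
  e₀ zero    = 1ℚ
  e₀ (suc _) = 0ℚ
  v·e₀≡0 : ∀ {v} → v zero ≡ 0ℚ → v · e₀ ≡ 0ℚ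
  v·e₀≡0 {v} v₀≡0 = trans (cong₂ _+_ (trans (cong (_* 1ℚ) v₀≡0) (*-zeroˡ 1ℚ)) (·-zeroʳ (v ∘ suc) λ _ → refl))
                           (+-identityˡ 0ℚ)
... | inj₂ (v , rest , v₀≢0 , vs↭v∷rest) =
  extend d , (suc (proj₁ d≢0) , proj₂ d≢0) ,
  All-resp-↭ (↭-sym vs↭v∷rest) (v⊥extend ∷ All.map (λ {u} → trans (·extend≡reduce· u d)) rest⊥d)
  where
  instance _ = ≢-nonZero v₀≢0
  open Elimination v
  |rest|<n : length (map reduce rest) ℕ.< n
  |rest|<n = subst (ℕ._< n) (sym (length-map reduce rest))
               (ℕₚ.≤-pred (subst (ℕ._< suc n) (↭-length vs↭v∷rest) |vs|<1+n))
  IH = ∃-orthogonal n (map reduce rest) |rest|<n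
  d = proj₁ IH
  d≢0 = proj₁ (proj₂ IH)
  rest⊥d : All (λ u → reduce u · d ≡ 0ℚ) rest
  rest⊥d = Allₚ.map⁻ (proj₂ (proj₂ IH))
  v⊥extend : v · extend d ≡ 0ℚ
  v⊥extend = trans (·extend≡reduce· v d) (·-zeroˡ d reduce-pivot≡0)

Small : ∀ {n} → (Fin n → ℚ) → Set
Small {n} e = ∀ (S : Subset n) → ∣ sumSub S e ∣ ≤ ½

∃-small-multiple : ∀ {n} (d : Fin n → ℚ) → ∃ λ ε → 0ℚ < ε × Small (λ i → ε * d i)
∃-small-multiple {n} d = ε , 0<ε , small
  where
  M = 1ℚ + sumSub ⊤ (∣_∣ ∘ d)
  0<M : 0ℚ < M
  0<M = <-≤-trans (positive⁻¹ 1ℚ) (p≤p+q (sumSub-nonneg ⊤ (0≤∣p∣ ∘ d)))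
  instance
    M-positive : Positive M
    M-positive = positive 0<M
    M-nonZero : NonZero M
    M-nonZero = pos⇒nonZero M
  ε = ½ * 1/ M
  0<ε : 0ℚ < ε
  0<ε = positive⁻¹ ε {{pos*pos⇒pos ½ (1/ M) {{1/pos⇒pos M}}}}
  small : Small (λ i → ε * d i)
  small S = begin
    ∣ sumSub S (λ i → ε * d i) ∣   ≡⟨ cong ∣_∣ (sumSub-*ˡ S ε d) ⟩
    ∣ ε * sumSub S d ∣             ≡⟨ trans (∣p*q∣≡∣p∣*∣q∣ ε _) (cong (_* ∣ sumSub S d ∣) ∣ε∣≡ε) ⟩
    ε * ∣ sumSub S d ∣             ≤⟨ *-monoˡ-≤-nonNeg ε {{nonNegative (<⇒≤ 0<ε)}} ∣Σd∣≤M ⟩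
    ε * M                          ≡⟨ trans (*-assoc ½ (1/ M) M) (trans (cong (½ *_) (*-inverseˡ M)) (*-identityʳ ½)) ⟩
    ½                              ∎
    where
    open ≤-Reasoning
    ∣ε∣≡ε : ∣ ε ∣ ≡ ε
    ∣ε∣≡ε = 0≤p⇒∣p∣≡p (<⇒≤ 0<ε)
    ∣Σd∣≤M : ∣ sumSub S d ∣ ≤ M
    ∣Σd∣≤M = ≤-trans (∣sumSub∣≤sumSub∣∣ S d)
                       (≤-trans (sumSub-mono-⊆ {S = S} (0≤∣p∣ ∘ d) (λ _ → ∈⊤)) (p≤q+p (<⇒≤ (positive⁻¹ 1ℚ))))

∃-small-orthogonal : ∀ n (vs : List (Fin n → ℚ)) → length vs ℕ.< n →
                     ∃ λ e → NonZeroVec e × All (λ v → v · e ≡ 0ℚ) vs × Small e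
∃-small-orthogonal n vs |vs|<n with ∃-orthogonal n vs |vs|<n
... | d , (i , dᵢ≢0) , vs⊥d with ∃-small-multiple d
...   | ε , 0<ε , small = (λ i → ε * d i) , (i , εdᵢ≢0) , All.map (λ {v} → v⊥εd {v}) vs⊥d , small
  where
  instance _ = >-nonZero 0<ε
  εdᵢ≢0 : ε * d i ≢ 0ℚ
  εdᵢ≢0 = dᵢ≢0 ∘ *-zero-cancelˡ ε (d i)
  v⊥εd : ∀ {v} → v · d ≡ 0ℚ → v · (λ i → ε * d i) ≡ 0ℚ
  v⊥εd {v} v·d≡0 = trans (·-scaleʳ v d ε) (trans (cong (ε *_) v·d≡0) (*-zeroʳ ε))

Small-neg : ∀ {n} {e : Fin n → ℚ} → Small e → Small (λ p → - e p)
Small-neg {e = e} e-small S = subst (_≤ ½) (sym (trans (cong ∣_∣ (sumSub-neg S e)) (∣-p∣≡∣p∣ (sumSub S e)))) (e-small S)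

module _ {n} (I : Instance n) where
  open Instance I

  covers-⊤ : ∀ S → Covers I ⊤ S
  covers-⊤ S p _ = proj₁ (union p) , ∈⊤ , proj₂ (union p)

  minCover-≤ : ∀ {U S} → Covers I U S → minCover I S ≤ cost I U
  minCover-≤ {U} {S} U⊇S =
    foldr-⊓-≤ _ (∈-map⁺ (cost I) (∈-filter⁺ (λ U → covers? I U S) (allSubsets-complete m U) U⊇S))

  minCover-greatest : ∀ {S b} → (∀ U → Covers I U S → b ≤ cost I U) → b ≤ minCover I S
  minCover-greatest {S} b≤covers = foldr-⊓-greatest _ _ (b≤covers ⊤ (covers-⊤ S)) λ p∈costs →
    let (U , U∈covers , p≡costU) = ∈-map⁻ (cost I) p∈costs
    in subst (_ ≤_) (sym p≡costU) (b≤covers U (proj₂ (∈-filter⁻ (λ U → covers? I U S) {xs = allSubsets m} U∈covers)))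

  θ-≤ : ∀ y {U S} → Covers I U S → θ I y S ≤ θpair I y (S , U)
  θ-≤ y {S = S} U⊇S = +-monoˡ-≤ (- val I y S) (minCover-≤ U⊇S)

  θ-greatest : ∀ y {S b} → (∀ U → Covers I U S → b ≤ θpair I y (S , U)) → b ≤ θ I y S
  θ-greatest y {S} {b} b≤θpair =
    subst (_≤ θ I y S) (solve 2 (λ b v → (b :+ v) :- v := b) refl b v)
      (+-monoˡ-≤ (- v) (minCover-greatest λ U U⊇S →
        subst (b + v ≤_) (solve 2 (λ c v → (c :- v) :+ v := c) refl (cost I U) v) (+-monoˡ-≤ v (b≤θpair U U⊇S))))
    where v = val I y S

  excessOn-cong : ∀ C′ {y y′} → (∀ p → y p ≡ y′ p) → excessOn I C′ y ≡ excessOn I C′ y′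
  excessOn-cong C′ y≗y′ =
    cong sort (map-cong (λ x → cong (λ z → cost I (proj₂ x) - z) (sumSub-cong (proj₁ x) λ {p} _ → y≗y′ p)) C′)

  coverage : (Fin m → ℚ) → Fin n → ℚ
  coverage x p = sumFin m (λ t → if does (p ∈? T t) then x t else 0ℚ)

  weak-duality : ∀ {y x} → (∀ p → 0ℚ ≤ y p) → (∀ t → val I y (T t) ≤ c t) → FracCover I x →
                 val I y ⊤ ≤ sumFin m (λ t → c t * x t)
  weak-duality {y} {x} y≥0 y-packs (x≥0 , x-covers) = begin
    sumSub ⊤ y                                        ≡⟨ sumSub-cong ⊤ (λ {p} _ → sym (*-identityʳ (y p))) ⟩
    sumSub ⊤ (λ p → y p * 1ℚ)                         ≤⟨ sumSub-mono-≤ ⊤ (λ p → scale (y≥0 p) (x-covers p)) ⟩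
    sumSub ⊤ (λ p → y p * coverage x p)               ≡⟨ sumSub-cong ⊤ (λ {p} _ → distribute p) ⟩
    sumSub ⊤ (λ p → sumSub ⊤ (λ t → y p * ind p t))   ≡⟨ sumSub-swap (λ p t → y p * ind p t) ⟩
    sumSub ⊤ (λ t → sumSub ⊤ (λ p → y p * ind p t))   ≡⟨ sumSub-cong ⊤ (λ {t} _ → collect t) ⟩
    sumSub ⊤ (λ t → x t * val I y (T t))              ≤⟨ sumSub-mono-≤ ⊤ (λ t → scale (x≥0 t) (y-packs t)) ⟩
    sumSub ⊤ (λ t → x t * c t)                        ≡⟨ trans (sumSub-cong ⊤ λ {t} _ → *-comm (x t) (c t)) (sumSub-⊤ m _) ⟩
    sumFin m (λ t → c t * x t)                        ∎
    where
    open ≤-Reasoning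
    scale : ∀ {a p q} → 0ℚ ≤ a → p ≤ q → a * p ≤ a * q
    scale {a} 0≤a = *-monoˡ-≤-nonNeg a {{nonNegative 0≤a}}
    ind : Fin n → Fin m → ℚ
    ind p t = if does (p ∈? T t) then x t else 0ℚ
    distribute : ∀ p → y p * coverage x p ≡ sumSub ⊤ (λ t → y p * ind p t)
    distribute p = trans (cong (y p *_) (sym (sumSub-⊤ m (ind p)))) (sym (sumSub-*ˡ ⊤ (y p) (ind p)))
    swap-if : ∀ b a z → a * (if b then z else 0ℚ) ≡ z * (if b then a else 0ℚ)
    swap-if true  a z = *-comm a z
    swap-if false a z = trans (*-zeroʳ a) (sym (*-zeroʳ z))
    collect : ∀ t → sumSub ⊤ (λ p → y p * ind p t) ≡ x t * val I y (T t)
    collect t = trans (sumSub-cong ⊤ (λ {p} _ → swap-if (does (p ∈? T t)) (y p) (x t)))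
                  (trans (sumSub-*ˡ (⊤ {n}) (x t) _) (cong (x t *_) (sumSub-indicator (T t) y)))

  lp-certificate : ∀ {v x y} → FracCover I x → sumFin m (λ t → c t * x t) ≡ v →
                   (∀ p → 0ℚ ≤ y p) → (∀ t → val I y (T t) ≤ c t) → val I y ⊤ ≡ v → IsLPValue I v
  lp-certificate x-frac x-cost y≥0 y-packs y-val =
    (_ , x-frac , x-cost) , λ x′ x′-frac → subst (_≤ _) y-val (weak-duality y≥0 y-packs x′-frac)

  IsLPValue-unique : ∀ {v v′} → IsLPValue I v → IsLPValue I v′ → v ≡ v′
  IsLPValue-unique ((x , x-frac , x-cost) , v-min) ((x′ , x′-frac , x′-cost) , v′-min) =
    ≤-antisym (subst (_ ≤_) x′-cost (v-min x′ x′-frac)) (subst (_ ≤_) x-cost (v′-min x x-frac))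

  Feasible⇒val≡ : ∀ {v y} → IsLPValue I v → Feasible I y → val I y ⊤ ≡ v
  Feasible⇒val≡ lp (_ , lp′) = IsLPValue-unique lp′ lp

  val≡⇒Feasible : ∀ {v y} → IsLPValue I v → (∀ p → 0ℚ ≤ y p) → val I y ⊤ ≡ v → Feasible I y
  val≡⇒Feasible lp y≥0 y-val = y≥0 , subst (IsLPValue I) (sym y-val) lp

-- The construction

module Construction (k : ℕ) where

  -- Goals here contain the concrete costs of the instance. Abstracting over them with `with`, or
  -- handing them to the ring solver, makes Agda normalise those costs, so case splits go through
  -- helper functions on Dec and Tri values and ring identities through separately proved lemmas.

  N : ℕ
  N = suc (suc k)

  T : Fin (suc N) → Subset N
  T zero    = ⊤
  T (suc i) = ⁅ i ⁆

  ⊤≢⁅⁆ : ∀ (j : Fin N) → ⊤ ≢ ⁅ j ⁆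
  ⊤≢⁅⁆ zero    ⊤≡⁅j⁆ with x∈⁅y⁆⇒x≡y zero (subst (suc zero ∈_) ⊤≡⁅j⁆ ∈⊤)
  ... | ()
  ⊤≢⁅⁆ (suc j) ⊤≡⁅j⁆ with x∈⁅y⁆⇒x≡y (suc j) (subst (zero ∈_) ⊤≡⁅j⁆ ∈⊤)
  ... | ()

  T-injective : Injective _≡_ _≡_ T
  T-injective {zero}  {zero}  _     = refl
  T-injective {zero}  {suc j} T≡T   = contradiction T≡T (⊤≢⁅⁆ j)
  T-injective {suc i} {zero}  T≡T   = contradiction (sym T≡T) (⊤≢⁅⁆ i)
  T-injective {suc i} {suc j} ⁅i⁆≡⁅j⁆ = cong suc (x∈⁅y⁆⇒x≡y j (subst (i ∈_) ⁅i⁆≡⁅j⁆ (x∈⁅x⁆ i)))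

  cℕ : Fin (suc N) → ℕ
  cℕ zero    = base5 (⊤ {N})
  cℕ (suc i) = 2 ℕ.* pow5 i

  I : Instance N
  I = record
    { m        = suc N
    ; T        = T
    ; distinct = T-injective
    ; c        = fromℕ ∘ cℕ
    ; c≥0      = fromℕ-nonneg ∘ cℕ
    ; union    = λ _ → zero , ∈⊤
    }

  y* : Fin N → ℚ
  y* = fromℕ ∘ pow5

  W : ℚ
  W = fromℕ (base5 (⊤ {N}))

  y*≥1 : ∀ p → 1ℚ ≤ y* p
  y*≥1 p = subst (_≤ y* p) fromℕ-1 (fromℕ-mono-≤ (ℕₚ.m^n>0 5 (toℕ p)))

  y*≥0 : ∀ p → 0ℚ ≤ y* p
  y*≥0 p = fromℕ-nonneg (pow5 p)

  val-y* : ∀ S → val I y* S ≡ fromℕ (base5 S)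
  val-y* S = sumSub-fromℕ S pow5

  cost-ℕ : ∀ U → cost I U ≡ fromℕ (sumSubℕ U cℕ)
  cost-ℕ U = sumSub-fromℕ U cℕ

  c-singleton : ∀ i → Instance.c I (suc i) ≡ y* i + y* i
  c-singleton i = trans (fromℕ-+ (pow5 i) _) (cong (λ z → y* i + fromℕ z) (ℕₚ.+-identityʳ (pow5 i)))

  val-∁ : ∀ {y} → val I y ⊤ ≡ W → ∀ S → val I y (∁ S) ≡ W - val I y S
  val-∁ {y} y⊤≡W S = trans (solve 2 (λ a b → b := (a :+ b) :- a) refl (val I y S) _)
                           (cong (_- val I y S) (trans (sumSub-∁ S y) y⊤≡W))

  val-y*-∁ : ∀ S → val I y* (∁ S) ≡ W - val I y* S
  val-y*-∁ = val-∁ (val-y* ⊤)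

  cover-cost-≥ : ∀ {U S} → Covers I U S → W ≤ cost I U ⊎ val I y* S + val I y* S ≤ cost I U
  cover-cost-≥ {inside  ∷ U} _   = inj₁ (p≤p+q (sumSub-nonneg U (fromℕ-nonneg ∘ cℕ ∘ suc)))
  cover-cost-≥ {outside ∷ U} {S} U⊇S = inj₂ (begin
    val I y* S + val I y* S           ≡⟨ sym (sumSub-+ S y* y*) ⟩
    sumSub S (λ i → y* i + y* i)      ≤⟨ sumSub-mono-⊆ (λ i → +-mono-≤ (y*≥0 i) (y*≥0 i)) S⊆U ⟩
    sumSub U (λ i → y* i + y* i)      ≡⟨ sumSub-cong U (λ {i} _ → sym (c-singleton i)) ⟩
    cost I (outside ∷ U)              ∎)
    where
    open ≤-Reasoning
    S⊆U : S ⊆ U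
    S⊆U {p} p∈S with U⊇S p p∈S
    ... | suc i , there i∈U , p∈⁅i⁆ = subst (_∈ U) (sym (x∈⁅y⁆⇒x≡y i p∈⁅i⁆)) i∈U

  θ*-≥ : ∀ {t} S → t ≤ val I y* S → t ≤ val I y* (∁ S) → t ≤ θ I y* S
  θ*-≥ {t} S t≤y*S t≤y*∁S = θ-greatest I y* λ U U⊇S → [ via-⊤ , via-singletons ]′ (cover-cost-≥ U⊇S)
    where
    v = val I y* S
    via-⊤ : ∀ {c} → W ≤ c → t ≤ c - v
    via-⊤ {c} W≤c = ≤-trans t≤y*∁S (subst (_≤ c - v) (sym (val-y*-∁ S)) (+-monoˡ-≤ (- v) W≤c))
    via-singletons : ∀ {c} → v + v ≤ c → t ≤ c - v
    via-singletons {c} 2v≤c = ≤-trans t≤y*S (subst (_≤ c - v) ([p+p]-p≡p v) (+-monoˡ-≤ (- v) 2v≤c))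

  U₀ : Subset (suc N)
  U₀ = inside ∷ ⊥

  U₀-covers : ∀ S → Covers I U₀ S
  U₀-covers S p _ = zero , here , ∈⊤

  cost-U₀ : cost I U₀ ≡ W
  cost-U₀ = trans (cong (W +_) (sumSub-⊥ (fromℕ ∘ cℕ ∘ suc))) (+-identityʳ W)

  y*-InCore : InCore I y*
  y*-InCore = y*≥0 , ≤-antisym (0≤p-q⇒q≤p (θ*-≥ ⊤ (y*⊤≥0 ⊤) (y*⊤≥0 (∁ ⊤)))) minCover≤y*⊤
            , λ S _ → θ*-≥ S (y*⊤≥0 S) (y*⊤≥0 (∁ S))
    where
    y*⊤≥0 : ∀ S → 0ℚ ≤ val I y* S
    y*⊤≥0 S = sumSub-nonneg S y*≥0
    minCover≤y*⊤ : minCover I ⊤ ≤ val I y* ⊤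
    minCover≤y*⊤ = subst (minCover I ⊤ ≤_) (trans cost-U₀ (sym (val-y* ⊤))) (minCover-≤ I (U₀-covers ⊤))

  x* : Fin (suc N) → ℚ
  x* zero    = 1ℚ
  x* (suc _) = 0ℚ

  x*-FracCover : FracCover I x*
  x*-FracCover = x*≥0 , λ p → ≤-reflexive (sym (coverage-x* p))
    where
    x*≥0 : ∀ t → 0ℚ ≤ x* t
    x*≥0 zero    = <⇒≤ (positive⁻¹ 1ℚ)
    x*≥0 (suc _) = ≤-refl
    if-const : ∀ b → (if b then 0ℚ else 0ℚ) ≡ 0ℚ
    if-const true  = refl
    if-const false = refl
    coverage-x* : ∀ p → coverage I x* p ≡ 1ℚ
    coverage-x* p =
      trans (cong₂ _+_ (cong (if_then 1ℚ else 0ℚ) (dec-true (p ∈? ⊤) ∈⊤)) singletons≡0) (+-identityʳ 1ℚ)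
      where
      singletons≡0 : sumFin N (λ i → if does (p ∈? ⁅ i ⁆) then 0ℚ else 0ℚ) ≡ 0ℚ
      singletons≡0 = trans (sym (sumSub-⊤ N (λ i → if does (p ∈? ⁅ i ⁆) then 0ℚ else 0ℚ)))
                       (trans (sumSub-cong ⊤ (λ {i} _ → if-const (does (p ∈? ⁅ i ⁆)))) (sumSub-zero (⊤ {N})))

  x*-cost : sumFin (suc N) (λ t → Instance.c I t * x* t) ≡ W
  x*-cost = trans (cong₂ _+_ (*-identityʳ W) (trans (sym (sumSub-⊤ N (λ i → Instance.c I (suc i) * 0ℚ)))
                    (trans (sumSub-cong ⊤ (λ {i} _ → *-zeroʳ (Instance.c I (suc i)))) (sumSub-zero (⊤ {N})))))
                  (+-identityʳ W)

  y*-packs : ∀ t → val I y* (T t) ≤ Instance.c I t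
  y*-packs zero    = ≤-reflexive (val-y* ⊤)
  y*-packs (suc i) = subst (_≤ Instance.c I (suc i)) (sym (sumSub-⁅⁆ i y*)) (subst (y* i ≤_) (sym (c-singleton i)) (p≤p+q (y*≥0 i)))

  LP≡W : IsLPValue I W
  LP≡W = lp-certificate I x*-FracCover x*-cost y*≥0 y*-packs (val-y* ⊤)

  y*-Feasible : Feasible I y*
  y*-Feasible = val≡⇒Feasible I LP≡W y*≥0 (val-y* ⊤)

  ∃-changed-player : ∀ {y} S → val I y S ≢ val I y* S → ∃ λ a → a ∈ S × y a ≢ y* a
  ∃-changed-player {y} S val≢ with Finₚ.any? (λ a → (a ∈? S) ×-dec ¬? (y a ≟ y* a))
  ... | yes found = found
  ... | no  none  = contradiction (sumSub-cong S λ {a} a∈S →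
                      decidable-stable (y a ≟ y* a) λ a-changed → none (a , a∈S , a-changed)) val≢

  changed-∁ : ∀ {y} → val I y ⊤ ≡ W → ∀ S → val I y S ≢ val I y* S → val I y (∁ S) ≢ val I y* (∁ S)
  changed-∁ {y} y⊤≡W S val≢ ∁val≡ = val≢ (begin
    val I y S               ≡⟨ sym (p-[p-q]≡q W (val I y S)) ⟩
    W - (W - val I y S)     ≡⟨ cong (λ z → W - z) W-val≡ ⟩
    W - (W - val I y* S)    ≡⟨ p-[p-q]≡q W (val I y* S) ⟩
    val I y* S              ∎)
    where
    open ≡-Reasoning
    W-val≡ : W - val I y S ≡ W - val I y* S
    W-val≡ = trans (sym (val-∁ {y} y⊤≡W S)) (trans ∁val≡ (val-y*-∁ S))

  θ*-≥-changed : ∀ {y t} → val I y ⊤ ≡ W → (∀ a → y a ≢ y* a → t ≤ y* a) →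
                 ∀ S → val I y S ≢ val I y* S → t ≤ θ I y* S
  θ*-≥-changed {y} {t} y⊤≡W t≤changed S val≢ = θ*-≥ S (t≤val S val≢) (t≤val (∁ S) (changed-∁ {y} y⊤≡W S val≢))
    where
    t≤val : ∀ S → val I y S ≢ val I y* S → t ≤ val I y* S
    t≤val S val≢ = let (a , a∈S , a-changed) = ∃-changed-player {y} S val≢
                   in ≤-trans (t≤changed a a-changed) (sumSub-≥-∈ y*≥0 a∈S)

  HappyNucleolus⇒≗y* : ∀ {y} → IsHappyNucleolus I y → ∀ p → y p ≡ y* p
  HappyNucleolus⇒≗y* {y} (y-Feasible , y-max) p =
    decidable-stable (y p ≟ y* p) λ p-changed → y-max y* y*-Feasible (excess-<lex p-changed)
    where
    y⊤≡W = Feasible⇒val≡ I LP≡W y-Feasible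
    excess-<lex : y p ≢ y* p → _<lex_ I (excess I y) (excess I y*)
    excess-<lex p-changed = sort-map-Lex-< (θ I y) (θ I y*) t witness
                              (All.tabulate λ {S} _ θ≢ → t≤θ* S (θ≢ ∘ cong (λ z → minCover I S - z)))
      where
      minimiser = ∃-argmin y* (λ a → ¬? (y a ≟ y* a)) (lose (∈-allFin p) p-changed)
      i₀ = proj₁ minimiser
      i₀-changed : y i₀ ≢ y* i₀
      i₀-changed = proj₁ (proj₂ (proj₂ minimiser))
      t = y* i₀
      t≤θ* : ∀ S → val I y S ≢ val I y* S → t ≤ θ I y* S
      t≤θ* = θ*-≥-changed {y} y⊤≡W λ a a-changed → All.lookup (proj₂ (proj₂ (proj₂ minimiser))) (∈-allFin a) a-changed
      coalition : ∀ S → Nonempty S → val I y S ≢ val I y* S → θ I y S < t →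
                  Any (λ S → θ I y S < t × θ I y S ≢ θ I y* S) (coalitions I)
      coalition S S≢∅ val≢ θ<t = lose (∈-filter⁺ nonempty? (allSubsets-complete N S) S≢∅)
                                      (θ<t , <⇒≢ (<-≤-trans θ<t (t≤θ* S val≢)))
      ⁅i₀⁆-changed : val I y ⁅ i₀ ⁆ ≢ val I y* ⁅ i₀ ⁆
      ⁅i₀⁆-changed val≡ = i₀-changed (trans (sym (sumSub-⁅⁆ i₀ y)) (trans val≡ (sumSub-⁅⁆ i₀ y*)))
      witness : Any (λ S → θ I y S < t × θ I y S ≢ θ I y* S) (coalitions I)
      witness = by-cases (<-cmp (y i₀) t)
        where
        by-cases : Tri (y i₀ < t) (y i₀ ≡ t) (t < y i₀) → Any (λ S → θ I y S < t × θ I y S ≢ θ I y* S) (coalitions I)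
        by-cases (tri≈ _ y≡t _) = contradiction y≡t i₀-changed
        by-cases (tri> _ _ t<y) = coalition ⁅ i₀ ⁆ (i₀ , x∈⁅x⁆ i₀) ⁅i₀⁆-changed (begin-strict
          θ I y ⁅ i₀ ⁆                               ≤⟨ θ-≤ I y {outside ∷ ⁅ i₀ ⁆} (λ _ p∈ → suc i₀ , there (x∈⁅x⁆ i₀) , p∈) ⟩
          cost I (outside ∷ ⁅ i₀ ⁆) - val I y ⁅ i₀ ⁆ ≡⟨ cong₂ _-_ (trans (sumSub-⁅⁆ i₀ (fromℕ ∘ cℕ ∘ suc)) (c-singleton i₀)) (sumSub-⁅⁆ i₀ y) ⟩
          (t + t) - y i₀                             <⟨ +-monoʳ-< (t + t) (neg-antimono-< t<y) ⟩
          (t + t) - t                                ≡⟨ [p+p]-p≡p t ⟩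
          t                                          ∎)
          where open ≤-Reasoning
        by-cases (tri< y<t _ _) = coalition (∁ ⁅ i₀ ⁆) (proj₁ ∁-changed , proj₁ (proj₂ ∁-changed)) ∁⁅i₀⁆-changed (begin-strict
          θ I y (∁ ⁅ i₀ ⁆)                           ≤⟨ θ-≤ I y (U₀-covers (∁ ⁅ i₀ ⁆)) ⟩
          cost I U₀ - val I y (∁ ⁅ i₀ ⁆)             ≡⟨ cong₂ _-_ cost-U₀ (trans (val-∁ {y} y⊤≡W ⁅ i₀ ⁆) (cong (λ z → W - z) (sumSub-⁅⁆ i₀ y))) ⟩
          W - (W - y i₀)                             ≡⟨ p-[p-q]≡q W (y i₀) ⟩
          y i₀                                       <⟨ y<t ⟩
          t                                          ∎)
          where
          open ≤-Reasoning
          ∁⁅i₀⁆-changed = changed-∁ {y} y⊤≡W ⁅ i₀ ⁆ ⁅i₀⁆-changed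
          ∁-changed = ∃-changed-player {y} (∁ ⁅ i₀ ⁆) ∁⁅i₀⁆-changed

  Pair : Set
  Pair = Subset N × Subset (suc N)

  A : Pair → ℚ
  A = θpair I y*

  costℕ : Subset (suc N) → ℕ
  costℕ U = sumSubℕ U cℕ

  A≡fromℕ : ∀ x → A x ≡ fromℕ (costℕ (proj₂ x)) - fromℕ (base5 (proj₁ x))
  A≡fromℕ (S , U) = cong₂ _-_ (cost-ℕ U) (val-y* S)

  A-gap : ∀ {x x′} → A x < A x′ → A x + 1ℚ ≤ A x′
  A-gap {S , U} {S′ , U′} Ax<Ax′ = subst₂ (λ a b → a + 1ℚ ≤ b) (sym (A≡fromℕ (S , U))) (sym (A≡fromℕ (S′ , U′)))
    (fromℕ-diff-gap (costℕ U) (base5 S) (costℕ U′) (base5 S′)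
      (subst₂ _<_ (A≡fromℕ (S , U)) (A≡fromℕ (S′ , U′)) Ax<Ax′))

  costℕ+base5≡digits : ∀ p U S → costℕ (p ∷ U) ℕ.+ base5 S ≡ digits p U S
  costℕ+base5≡digits inside  U S = cong (ℕ._+ base5 S)
    (cong₂ ℕ._+_ (sym (ℕₚ.*-identityˡ (base5 (⊤ {N})))) (sumSubℕ-*ˡ U 2 pow5))
  costℕ+base5≡digits outside U S = cong (ℕ._+ base5 S) (sumSubℕ-*ˡ U 2 pow5)

  A-coincidence : ∀ x x′ → A x ≡ A x′ → proj₁ x′ ≡ proj₁ x ⊎ proj₁ x′ ≡ ∁ (proj₁ x)
  A-coincidence (S , p ∷ U) (S′ , p′ ∷ U′) Ax≡Ax′ = by-bits (Bool._≟_ p p′)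
    where
    coincidence : (p ≡ p′ → S′ ≡ S) × (p ≢ p′ → S′ ≡ ∁ S)
    coincidence = digits-coincidence p p′ U U′ S S′
      (trans (sym (costℕ+base5≡digits p U S′)) (trans
        (fromℕ-diff-injective (costℕ (p ∷ U)) (base5 S) (costℕ (p′ ∷ U′)) (base5 S′)
          (trans (sym (A≡fromℕ (S , p ∷ U))) (trans Ax≡Ax′ (A≡fromℕ (S′ , p′ ∷ U′)))))
        (costℕ+base5≡digits p′ U′ S)))
    by-bits : Dec (p ≡ p′) → S′ ≡ S ⊎ S′ ≡ ∁ S
    by-bits (yes p≡p′) = inj₁ (proj₁ coincidence p≡p′)
    by-bits (no  p≢p′) = inj₂ (proj₂ coincidence p≢p′)

  perturb : (Fin N → ℚ) → Fin N → ℚ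
  perturb e p = y* p + e p

  θpair-perturb : ∀ e x → θpair I (perturb e) x ≡ A x - sumSub (proj₁ x) e
  θpair-perturb e (S , U) = trans (cong (λ z → cost I U - z) (sumSub-+ S y* e)) (p-[q+r]≡p-q-r (cost I U) (val I y* S) (sumSub S e))

  perturb-Feasible : ∀ {e} → Small e → sumSub ⊤ e ≡ 0ℚ → Feasible I (perturb e)
  perturb-Feasible {e} e-small e⊤≡0 = val≡⇒Feasible I LP≡W perturb≥0
    (trans (sumSub-+ ⊤ y* e) (trans (cong₂ _+_ (val-y* ⊤) e⊤≡0) (+-identityʳ W)))
    where
    perturb≥0 : ∀ p → 0ℚ ≤ perturb e p
    perturb≥0 p = ≤-trans (<⇒≤ (positive⁻¹ ½))
      (+-mono-≤ (y*≥1 p) (subst (- ½ ≤_) (sumSub-⁅⁆ p e) (∣p∣≤q⇒-q≤p (e-small ⁅ p ⁆))))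

  Partner : Pair → Pair → Set
  Partner x x′ = proj₁ x′ ≡ ∁ (proj₁ x) × A x ≡ A x′

  Partner-sym : ∀ {x x′} → Partner x x′ → Partner x′ x
  Partner-sym {x} (S′≡∁S , Ax≡Ax′) = trans (sym (∁-involutive (proj₁ x))) (cong ∁ (sym S′≡∁S)) , sym Ax≡Ax′

  module _ (C′ : List Pair) where

    Partnered : Pair → Set
    Partnered x = Any (Partner x) C′

    partnered? : ∀ x → Dec (Partnered x)
    partnered? x = any? (λ x′ → (proj₁ x′ ≟ₛ ∁ (proj₁ x)) ×-dec (A x ≟ A x′)) C′

    Zero∉Partnered : Pair → Set
    Zero∉Partnered x = zero ∉ proj₁ x × Partnered x

    zero∉partnered? : ∀ x → Dec (Zero∉Partnered x)
    zero∉partnered? x = ¬? (zero ∈? proj₁ x) ×-dec partnered? x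

    partnered-sets : List (Subset N)
    partnered-sets = deduplicate _≟ₛ_ (map proj₁ (filter zero∉partnered? C′))

    ∈-partnered-sets⁺ : ∀ {x} → x ∈ₗ C′ → Zero∉Partnered x → proj₁ x ∈ₗ partnered-sets
    ∈-partnered-sets⁺ x∈C′ x-zp = ∈-deduplicate⁺ _≟ₛ_ (∈-map⁺ proj₁ (∈-filter⁺ zero∉partnered? x∈C′ x-zp))

    ∈-partnered-sets⁻ : ∀ {S} → S ∈ₗ partnered-sets → ∃ λ x → x ∈ₗ C′ × proj₁ x ≡ S × Zero∉Partnered x
    ∈-partnered-sets⁻ S∈ with ∈-map⁻ proj₁ (∈-deduplicate⁻ _≟ₛ_ _ S∈)
    ... | x , x∈filter , refl =
      let x∈C′ , x-zp = ∈-filter⁻ zero∉partnered? {xs = C′} x∈filter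
      in x , x∈C′ , refl , x-zp

    zero∉partnered-set : ∀ {S} → S ∈ₗ partnered-sets → zero ∉ S
    zero∉partnered-set S∈K with ∈-partnered-sets⁻ S∈K
    ... | _ , _ , refl , zero∉S , _ = zero∉S

    2*|partnered-sets|≤|C′| : 2 ℕ.* length partnered-sets ℕ.≤ length C′
    2*|partnered-sets|≤|C′| = subst₂ ℕ._≤_ |K++∁K| (length-map proj₁ C′) (Unique-⊆⇒length≤ K++∁K! K++∁K⊆C′)
      where
      K = partnered-sets
      |K++∁K| : length (K ++ map ∁ K) ≡ 2 ℕ.* length K
      |K++∁K| = trans (length-++ K) (cong (length K ℕ.+_) (trans (length-map ∁ K) (sym (ℕₚ.+-identityʳ (length K)))))
      K∩∁K≡∅ : ∀ {S} → ¬ (S ∈ₗ K × S ∈ₗ map ∁ K)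
      K∩∁K≡∅ (S∈K , S∈∁K) with ∈-map⁻ ∁ S∈∁K
      ... | S′ , S′∈K , refl = zero∉partnered-set S∈K (x∉p⇒x∈∁p (zero∉partnered-set S′∈K))
      K++∁K! : Unique (K ++ map ∁ K)
      K++∁K! = Uniqueₚ.++⁺ (deduplicate-! _≟ₛ_ _) (Uniqueₚ.map⁺ ∁-injective (deduplicate-! _≟ₛ_ _)) K∩∁K≡∅
      K++∁K⊆C′ : ∀ {S} → S ∈ₗ K ++ map ∁ K → S ∈ₗ map proj₁ C′
      K++∁K⊆C′ S∈ with ∈-++⁻ K S∈
      ... | inj₁ S∈K with ∈-partnered-sets⁻ S∈K
      ...   | x , x∈C′ , refl , _ = ∈-map⁺ proj₁ x∈C′
      K++∁K⊆C′ S∈ | inj₂ S∈∁K with ∈-map⁻ ∁ S∈∁K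
      ... | S′ , S′∈K , refl with ∈-partnered-sets⁻ S′∈K
      ...   | x , x∈C′ , refl , _ , x-partnered with find x-partnered
      ...     | x′ , x′∈C′ , S′≡∁S , _ = subst (_∈ₗ map proj₁ C′) S′≡∁S (∈-map⁺ proj₁ x′∈C′)

    partnered-vanish : ∀ {e} → sumSub ⊤ e ≡ 0ℚ → (∀ {S} → S ∈ₗ partnered-sets → sumSub S e ≡ 0ℚ) →
                       ∀ {x} → x ∈ₗ C′ → Partnered x → sumSub (proj₁ x) e ≡ 0ℚ
    partnered-vanish {e} e⊤≡0 eK≡0 {x} x∈C′ x-partnered with zero ∈? proj₁ x
    ... | no  zero∉S = eK≡0 (∈-partnered-sets⁺ x∈C′ (zero∉S , x-partnered))
    ... | yes zero∈S with find x-partnered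
    ...   | x′ , x′∈C′ , x-partner-x′ = begin
      sumSub S e                          ≡⟨ sym (+-identityʳ (sumSub S e)) ⟩
      sumSub S e + 0ℚ                     ≡⟨ cong (sumSub S e +_) (sym e∁S≡0) ⟩
      sumSub S e + sumSub (∁ S) e         ≡⟨ sumSub-∁ S e ⟩
      sumSub ⊤ e                          ≡⟨ e⊤≡0 ⟩
      0ℚ                                  ∎
      where
      open ≡-Reasoning
      S = proj₁ x
      x′-zp : Zero∉Partnered x′
      x′-zp = subst (zero ∉_) (sym (proj₁ x-partner-x′)) (x∈p⇒x∉∁p zero∈S)
            , lose x∈C′ (Partner-sym {x} {x′} x-partner-x′)
      e∁S≡0 : sumSub (∁ S) e ≡ 0ℚ
      e∁S≡0 = subst (λ S′ → sumSub S′ e ≡ 0ℚ) (proj₁ x-partner-x′) (eK≡0 (∈-partnered-sets⁺ x′∈C′ x′-zp))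

    ∃-perturbation : length C′ ℕ.< 2 ℕ.* N ℕ.∸ 2 →
                     ∃ λ e → NonZeroVec e × Small e × sumSub ⊤ e ≡ 0ℚ ×
                             (∀ {x} → x ∈ₗ C′ → Partnered x → sumSub (proj₁ x) e ≡ 0ℚ)
    ∃-perturbation |C′|<2N-2 = e , e≢0 , e-small , e⊤≡0 , partnered-vanish e⊤≡0 eK≡0
      where
      K = partnered-sets
      |χ⊤∷χK|<N : length (χ ⊤ ∷ map χ K) ℕ.< N
      |χ⊤∷χK|<N = subst (λ l → suc l ℕ.< N) (sym (length-map χ K))
                    (2a≤b⇒b<2n∸2⇒1+a<n 2*|partnered-sets|≤|C′| |C′|<2N-2)
      orthogonal = ∃-small-orthogonal N (χ ⊤ ∷ map χ K) |χ⊤∷χK|<N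
      e = proj₁ orthogonal
      e≢0 = proj₁ (proj₂ orthogonal)
      e-small = proj₂ (proj₂ (proj₂ orthogonal))
      ⊤∷K⊥e : All (λ v → v · e ≡ 0ℚ) (χ ⊤ ∷ map χ K)
      ⊤∷K⊥e = proj₁ (proj₂ (proj₂ orthogonal))
      e⊤≡0 : sumSub ⊤ e ≡ 0ℚ
      e⊤≡0 = trans (sym (χ·≡sumSub ⊤ e)) (All.head ⊤∷K⊥e)
      eK≡0 : ∀ {S} → S ∈ₗ K → sumSub S e ≡ 0ℚ
      eK≡0 {S} S∈K = trans (sym (χ·≡sumSub S e)) (All.lookup (Allₚ.map⁻ (All.tail ⊤∷K⊥e)) S∈K)

    LeastChanged : (Fin N → ℚ) → Pair → Set
    LeastChanged e x₀ = All (λ x → sumSub (proj₁ x) e ≢ 0ℚ → A x₀ ≤ A x × (A x ≡ A x₀ → proj₁ x ≡ proj₁ x₀)) C′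

    perturbation-improves : ∀ {e x₀} → Small e → x₀ ∈ₗ C′ → sumSub (proj₁ x₀) e < 0ℚ → LeastChanged e x₀ →
                            _<lex_ I (excessOn I C′ y*) (excessOn I C′ (perturb e))
    perturbation-improves {e} {x₀} e-small x₀∈C′ δ₀<0 separated =
      sort-map-Lex-< A B t (lose x₀∈C′ (A₀<t , λ A₀≡B₀ → <⇒≢ A₀<t (trans A₀≡B₀ (θpair-perturb e x₀))))
        (All.map (λ {x} → t≤B x) separated)
      where
      B = θpair I (perturb e)
      δ : Pair → ℚ
      δ x = sumSub (proj₁ x) e
      t = A x₀ - δ x₀
      A₀<t : A x₀ < t
      A₀<t = subst (_< t) (+-identityʳ (A x₀)) (+-monoʳ-< (A x₀) (neg-antimono-< δ₀<0))
      t≤B : ∀ x → (δ x ≢ 0ℚ → A x₀ ≤ A x × (A x ≡ A x₀ → proj₁ x ≡ proj₁ x₀)) → A x ≢ B x → t ≤ B x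
      t≤B x separated-x A≢B = by-value (A x ≟ A x₀)
        where
        δ≢0 : δ x ≢ 0ℚ
        δ≢0 δ≡0 = A≢B (sym (trans (θpair-perturb e x) (trans (cong (λ z → A x - z) δ≡0) (+-identityʳ (A x)))))
        by-value : Dec (A x ≡ A x₀) → t ≤ B x
        by-value (yes A≡A₀) = ≤-reflexive (sym (trans (θpair-perturb e x)
                                (cong₂ _-_ A≡A₀ (cong (λ S → sumSub S e) (proj₂ (separated-x δ≢0) A≡A₀)))))
        by-value (no  A≢A₀) = subst (t ≤_) (sym (θpair-perturb e x))
          (unit-gap-absorbs-½ {A x₀} {A x} {δ x₀} {δ x}
            (A-gap {x₀} {x} (≤∧≢⇒< (proj₁ (separated-x δ≢0)) (A≢A₀ ∘′ sym)))
            (e-small (proj₁ x₀)) (e-small (proj₁ x)))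

    changed? : ∀ (e : Fin N → ℚ) (x : Pair) → Dec (sumSub (proj₁ x) e ≢ 0ℚ)
    changed? e x = ¬? (sumSub (proj₁ x) e ≟ 0ℚ)

    minimal⇒LeastChanged : ∀ {e x₀} → (∀ {x} → x ∈ₗ C′ → Partnered x → sumSub (proj₁ x) e ≡ 0ℚ) →
                        x₀ ∈ₗ C′ → sumSub (proj₁ x₀) e ≢ 0ℚ →
                        All (λ x → sumSub (proj₁ x) e ≢ 0ℚ → A x₀ ≤ A x) C′ → LeastChanged e x₀
    minimal⇒LeastChanged {e} {x₀} vanishes x₀∈C′ x₀-changed minimal = All.tabulate separated
      where
      separated : ∀ {x} → x ∈ₗ C′ → sumSub (proj₁ x) e ≢ 0ℚ → A x₀ ≤ A x × (A x ≡ A x₀ → proj₁ x ≡ proj₁ x₀)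
      separated {x} x∈C′ x-changed = All.lookup minimal x∈C′ x-changed , λ A≡A₀ →
        [ id , (λ S≡∁S₀ → contradiction (vanishes x₀∈C′ (lose x∈C′ (S≡∁S₀ , sym A≡A₀))) x₀-changed) ]′
          (A-coincidence x₀ x (sym A≡A₀))

    LeastChanged-neg : ∀ {e x₀} → LeastChanged e x₀ → LeastChanged (λ p → - e p) x₀
    LeastChanged-neg {e} = All.map λ {x} separated -δ≢0 → separated (-δ≢0 ∘ λ δ≡0 → trans (sumSub-neg (proj₁ x) e) (cong -_ δ≡0))

    ∃-improving-perturbation : ∀ {e} → Small e → sumSub ⊤ e ≡ 0ℚ →
                               (∀ {x} → x ∈ₗ C′ → Partnered x → sumSub (proj₁ x) e ≡ 0ℚ) →
                               Any (λ x → sumSub (proj₁ x) e ≢ 0ℚ) C′ →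
                               ∃ λ e′ → Feasible I (perturb e′) × _<lex_ I (excessOn I C′ y*) (excessOn I C′ (perturb e′))
    ∃-improving-perturbation {e} e-small e⊤≡0 vanishes some = by-sign (<-cmp (sumSub (proj₁ x₀) e) 0ℚ)
      where
      minimiser = ∃-argmin A (changed? e) some
      x₀ = proj₁ minimiser
      x₀∈C′ = proj₁ (proj₂ minimiser)
      x₀-changed = proj₁ (proj₂ (proj₂ minimiser))
      separated : LeastChanged e x₀
      separated = minimal⇒LeastChanged vanishes x₀∈C′ x₀-changed (proj₂ (proj₂ (proj₂ minimiser)))
      e⁻ : Fin N → ℚ
      e⁻ p = - e p
      by-sign : Tri (sumSub (proj₁ x₀) e < 0ℚ) (sumSub (proj₁ x₀) e ≡ 0ℚ) (0ℚ < sumSub (proj₁ x₀) e) →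
                ∃ λ e′ → Feasible I (perturb e′) × _<lex_ I (excessOn I C′ y*) (excessOn I C′ (perturb e′))
      by-sign (tri< δ₀<0 _ _) = e , perturb-Feasible e-small e⊤≡0 , perturbation-improves e-small x₀∈C′ δ₀<0 separated
      by-sign (tri≈ _ δ₀≡0 _) = contradiction δ₀≡0 x₀-changed
      by-sign (tri> _ _ δ₀>0) = e⁻ , perturb-Feasible (Small-neg e-small) (trans (sumSub-neg ⊤ e) (cong -_ e⊤≡0))
                              , perturbation-improves (Small-neg e-small) x₀∈C′
                                  (subst (_< 0ℚ) (sym (sumSub-neg (proj₁ x₀) e)) (neg-antimono-< δ₀>0))
                                  (LeastChanged-neg {e} {x₀} separated)

    perturbation-refutes-uniqueness : ∀ {e} → NonZeroVec e → Small e → sumSub ⊤ e ≡ 0ℚ →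
                                      (∀ {x} → x ∈ₗ C′ → Partnered x → sumSub (proj₁ x) e ≡ 0ℚ) →
                                      LexMaxOn I C′ y* → ¬ (∀ y → LexMaxOn I C′ y → ∀ p → y p ≡ y* p)
    perturbation-refutes-uniqueness {e} (i , eᵢ≢0) e-small e⊤≡0 vanishes (_ , y*-max) unique =
      by-change (any? (changed? e) C′)
      where
      by-change : Dec (Any (λ x → sumSub (proj₁ x) e ≢ 0ℚ) C′) → Empty.⊥
      by-change (yes some) = let (e′ , e′-Feasible , improves) = ∃-improving-perturbation e-small e⊤≡0 vanishes some
                             in y*-max (perturb e′) e′-Feasible improves
      by-change (no  none) = eᵢ≢0 (p+q≡p⇒q≡0 (unique (perturb e) (perturb-Feasible e-small e⊤≡0 , perturb-max) i))
        where
        unchanged : excessOn I C′ (perturb e) ≡ excessOn I C′ y*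
        unchanged = cong sort (map-cong-local (All.tabulate λ {x} x∈C′ →
          trans (θpair-perturb e x)
            (trans (cong (λ z → A x - z) (decidable-stable (_ ≟ 0ℚ) (none ∘ lose x∈C′))) (+-identityʳ (A x)))))
        perturb-max : ∀ y → Feasible I y → ¬ _<lex_ I (excessOn I C′ (perturb e)) (excessOn I C′ y)
        perturb-max y y-Feasible = y*-max y y-Feasible ∘ subst (λ v → _<lex_ I v (excessOn I C′ y)) unchanged

    LexMax-not-unique : length C′ ℕ.< 2 ℕ.* N ℕ.∸ 2 → LexMaxOn I C′ y* →
                        ¬ (∀ y → LexMaxOn I C′ y → ∀ p → y p ≡ y* p)
    LexMax-not-unique |C′|<2N-2 =
      let (_ , e≢0 , e-small , e⊤≡0 , vanishes) = ∃-perturbation |C′|<2N-2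
      in perturbation-refutes-uniqueness e≢0 e-small e⊤≡0 vanishes

  no-small-determining-family : ∀ C′ → length C′ ℕ.< 2 ℕ.* N ℕ.∸ 2 → ¬ Determines I C′
  no-small-determining-family C′ |C′|<2N-2 (y , y-nucleolus , (y-Feasible , y-max) , y-unique) =
    LexMax-not-unique C′ |C′|<2N-2 (y*-Feasible , y*-max) y*-unique
    where
    y≗y* = HappyNucleolus⇒≗y* y-nucleolus
    y*-max : ∀ y′ → Feasible I y′ → ¬ _<lex_ I (excessOn I C′ y*) (excessOn I C′ y′)
    y*-max y′ y′-Feasible =
      y-max y′ y′-Feasible ∘ subst (λ v → _<lex_ I v (excessOn I C′ y′)) (excessOn-cong I C′ (sym ∘ y≗y*))
    y*-unique : ∀ y′ → LexMaxOn I C′ y′ → ∀ p → y′ p ≡ y* p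
    y*-unique y′ y′-max p = trans (y-unique y′ y′-max p) (y≗y* p)

-- For n < 2 the bound 2n ∸ 2 is 0 and any instance will do; the construction needs two players
-- for P to differ from the singletons.
single-set-instance : ∀ n → Instance n
single-set-instance n = record
  { m = 1 ; T = λ _ → ⊤ ; distinct = λ { {zero} {zero} _ → refl } ; c = λ _ → 0ℚ ; c≥0 = λ _ → ≤-refl
  ; union = λ p → zero , ∈⊤ }

zero-InCore : ∀ n → InCore (single-set-instance n) (λ _ → 0ℚ)
zero-InCore n = (λ _ → ≤-refl) , trans (sumSub-zero (⊤ {n})) (sym minCover⊤≡0)
              , λ S _ → θ-greatest I (λ _ → 0ℚ) λ U _ → ≤-reflexive (sym (cong₂ _-_ (sumSub-zero U) (sumSub-zero S)))
  where
  I = single-set-instance n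
  minCover⊤≡0 : minCover I ⊤ ≡ 0ℚ
  minCover⊤≡0 = ≤-antisym (subst (minCover I ⊤ ≤_) (sumSub-zero (⊤ {1})) (minCover-≤ I (covers-⊤ I ⊤)))
                          (minCover-greatest I λ U _ → ≤-reflexive (sym (sumSub-zero U)))

theorem3 : ∀ (n : ℕ) → Σ (Instance n) λ I → CoreNonempty I
           × (∀ (C' : List (Subset n × Subset (Instance.m I))) → SubfamilyOf𝒞 I C'
               → length C' ℕ.< 2 ℕ.* n ℕ.∸ 2 → ¬ Determines I C')
theorem3 zero          = single-set-instance 0 , (_ , zero-InCore 0) , λ _ _ ()
theorem3 (suc zero)    = single-set-instance 1 , (_ , zero-InCore 1) , λ _ _ ()
theorem3 (suc (suc k)) = Construction.I k , (Construction.y* k , Construction.y*-InCore k)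
                       , λ C′ _ → Construction.no-small-determining-family k C′
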